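{- Let $M=M[\mathcal{I}]$ be a multi-path matroid on $S$ of rank $r$ and nullity $m$, presented by an antichain $\mathcal{I}$ of $\sigma$-intervals, and fix $x\in S$. A set $B\subseteq S$ is a basis of $M$ if and only if there is a lattice path $R$ such that (i) $R$ goes from some point $p_i$ to the corresponding point $p'_i$ ($1\le i\le k$), (ii) $R$ uses East and North steps of the diagram $D(\mathcal{I},x)$ (i.e. $R$ stays in its region), and (iii) the labels on the North steps of $R$ are exactly the elements of $B$.
   Context: Transversal matroid $M[\mathcal{A}]$ of a multiset $\mathcal{A}$ of subsets of a finite set $S$: its independent sets are the partial transversals (sets of distinct elements chosen from distinct members, one from each chosen member). For a cyclic permutation $\sigma$ of $S$, a $\sigma$-interval is a nonempty set $I=\{f_I,\sigma(f_I),\ldots,l_I\}$ with first element $f_I$ and last element $l_I$. $\mathcal{I}$ is an antichain (no member contains another) of $r$ $\sigma$-intervals; $|S|=m+r$. The diagram $D(\mathcal{I},x)$: let $k-1$ be the number of intervals $I\in\mathcal{I}$ with $x\in I$ and $x\ne f_I$. For $1\le i\le k$ let $p_i=(k-i,i-1)$ and $p'_i=p_i+(m,r)$; let $L$, $L'$ be the lines of slope $-1$ through the $p_i$, resp. the $p'_i$. Let $P$ be the lattice path from $p_1$ to $p'_1$ whose $t$-th step ($1\le t\le m+r$) is North $(0,1)$ if $\sigma^{t-1}(x)$ is the last element of some interval of $\mathcal{I}$ and East $(1,0)$ otherwise; let $Q$ be the lattice path from $p_k$ to $p'_k$ whose $t$-th step is North if $\sigma^{t-1}(x)$ is the first element of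 some interval of $\mathcal{I}$ and East otherwise ($P$ never goes above $Q$). The region of the diagram is the closed region bounded by $L$, $L'$, $P$, $Q$; its steps (edges) are the unit segments between lattice points lying in it. A step starting at the lattice point $(a,b)$ with $a+b=k-1+(t-1)$ (i.e. the $t$-th step of any lattice path starting on $L$) is labelled $\sigma^{t-1}(x)$. -}

module Defs where

open import Data.Nat using (ℕ; zero; suc; _+_; _∸_; _≤_)
open import Data.Fin using (Fin; toℕ)
open import Data.Fin.Properties using (any?; _≟_)
open import Data.Fin.Subset using (Subset; _∈_; _⊆_; ∣_∣)
open import Data.Fin.Permutation using (Permutation′; _⟨$⟩ʳ_)
open import Data.Product using (Σ; ∃; _×_; _,_; proj₂)
open import Data.List using (List; length; filter; upTo; allFin)
open import Data.Vec using (Vec; []; _∷_; lookup)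
open import Data.Unit using (⊤)
open import Relation.Nullary using (¬_; Dec)
open import Relation.Nullary.Decidable using (_×-dec_; ¬?)
open import Relation.Binary.PropositionalEquality using (_≡_)
open import Function.Bundles using (_⇔_)

iter : ∀ {A : Set} → (A → A) → ℕ → A → A
iter f zero a = a
iter f (suc t) a = f (iter f t a)

_^_·_ : ∀ {n} → Permutation′ n → ℕ → Fin n → Fin n
σ ^ t · y = iter (σ ⟨$⟩ʳ_) t y

IsCyclic : ∀ {n} → Permutation′ n → Set
IsCyclic {n} σ = ∀ (y z : Fin n) → ∃ λ t → σ ^ t · y ≡ z

-- A σ-interval {f, σ f, ..., l}, given by its first element f and its
-- number of elements len (1 ≤ len ≤ |S|); its last element is σ^(len-1) f.
record Interval (n : ℕ) : Set where
  constructor interval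
  field
    first   : Fin n
    len     : ℕ
    len-pos : 1 ≤ len
    len-≤   : len ≤ n
open Interval public

Elem : ∀ {n} → Permutation′ n → Interval n → Fin n → Set
Elem σ I y = ∃ λ (j : Fin (len I)) → σ ^ toℕ j · first I ≡ y

elem? : ∀ {n} (σ : Permutation′ n) (I : Interval n) (y : Fin n) → Dec (Elem σ I y)
elem? σ I y = any? (λ j → σ ^ toℕ j · first I ≟ y)

lastElem : ∀ {n} → Permutation′ n → Interval n → Fin n
lastElem σ I = σ ^ (len I ∸ 1) · first I

Antichain : ∀ {n r} → Permutation′ n → (Fin r → Interval n) → Set
Antichain σ 𝓘 = ∀ i j → ¬ i ≡ j → ¬ (∀ y → Elem σ (𝓘 i) y → Elem σ (𝓘 j) y)

-- Transversal matroid M[𝓘]: independent sets are the partial transversals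
-- (distinct elements taken from distinct members)
Independent : ∀ {n r} → Permutation′ n → (Fin r → Interval n) → Subset n → Set
Independent {n} {r} σ 𝓘 B =
  ∃ λ (φ : Fin n → Fin r) →
    (∀ y → y ∈ B → Elem σ (𝓘 (φ y)) y) ×
    (∀ y z → y ∈ B → z ∈ B → φ y ≡ φ z → y ≡ z)

IsBasis : ∀ {n r} → Permutation′ n → (Fin r → Interval n) → Subset n → Set
IsBasis σ 𝓘 B =
  Independent σ 𝓘 B × (∀ B′ → Independent σ 𝓘 B′ → B ⊆ B′ → B′ ⊆ B)

HasRank : ∀ {n r} → Permutation′ n → (Fin r → Interval n) → ℕ → Set
HasRank {n} σ 𝓘 ρ =
  (∃ λ (B : Subset n) → Independent σ 𝓘 B × ∣ B ∣ ≡ ρ) ×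
  (∀ (B : Subset n) → Independent σ 𝓘 B → ∣ B ∣ ≤ ρ)

Point : Set
Point = ℕ × ℕ

data Dir : Set where
  East North : Dir

move : Point → Dir → Point
move (a , b) East  = (suc a , b)
move (a , b) North = (a , suc b)

endOf : ∀ {t} → Point → Vec Dir t → Point
endOf p []       = p
endOf p (d ∷ ds) = endOf (move p d) ds

module Diagram (m r : ℕ) (σ : Permutation′ (m + r))
               (𝓘 : Fin r → Interval (m + r)) (x : Fin (m + r)) where

  k-1 : ℕ
  k-1 = length (filter (λ i → elem? σ (𝓘 i) x ×-dec ¬? (x ≟ first (𝓘 i))) (allFin r))

  k : ℕ
  k = suc k-1

  p : ℕ → Point
  p i = (k ∸ i , i ∸ 1)

  p′ : ℕ → Point
  p′ i = (k ∸ i + m , i ∸ 1 + r)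

  isLast? : ∀ y → Dec (∃ λ (i : Fin r) → lastElem σ (𝓘 i) ≡ y)
  isLast? y = any? (λ i → lastElem σ (𝓘 i) ≟ y)

  isFirst? : ∀ y → Dec (∃ λ (i : Fin r) → first (𝓘 i) ≡ y)
  isFirst? y = any? (λ i → first (𝓘 i) ≟ y)

  -- number of North steps among the first d steps of P, resp. Q
  -- (the t-th step, 1 ≤ t ≤ d, concerns σ^(t-1)(x))
  northP : ℕ → ℕ
  northP d = length (filter (λ t → isLast? (σ ^ t · x)) (upTo d))

  northQ : ℕ → ℕ
  northQ d = length (filter (λ t → isFirst? (σ ^ t · x)) (upTo d))

  -- the vertex of P (from p_1 = (k-1, 0)), resp. Q (from p_k = (0, k-1)),
  -- after d steps
  P : ℕ → Point
  P d = (k-1 + (d ∸ northP d) , northP d)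

  Q : ℕ → Point
  Q d = (d ∸ northQ d , k-1 + northQ d)

  -- a lattice point lies in the closed region bounded by L, L', P, Q:
  -- it lies on a slope -1 line a + b = k-1+d with 0 ≤ d ≤ m+r, between
  -- the vertices P d and Q d on that line
  InRegion : Point → Set
  InRegion (a , b) = Σ ℕ λ d →
    d ≤ m + r × a + b ≡ k-1 + d × proj₂ (P d) ≤ b × b ≤ proj₂ (Q d)

  UsesDiagramSteps : ∀ {t} → Point → Vec Dir t → Set
  UsesDiagramSteps q []       = ⊤
  UsesDiagramSteps q (d ∷ ds) =
    InRegion q × InRegion (move q d) × UsesDiagramSteps (move q d) ds

  -- B is read off a lattice path R from some p_i to p'_i using diagram
  -- steps, whose North-step labels are exactly B (the t-th step, 1 ≤ t ≤ m+r,
  -- of a path starting on L is labelled σ^(t-1)(x))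
  HasBasisPath : Subset (m + r) → Set
  HasBasisPath B = Σ ℕ λ i → 1 ≤ i × i ≤ k ×
    Σ (Vec Dir (m + r)) λ R →
      endOf (p i) R ≡ p′ i ×
      UsesDiagramSteps (p i) R ×
      (∀ y → (y ∈ B) ⇔ (∃ λ (t : Fin (m + r)) → lookup R t ≡ North × σ ^ toℕ t · x ≡ y))

module Submission where

-- Measure every element by its distance from x along σ. An interval becomes a window [start, end)
-- of positions, which runs past n exactly when the interval contains x without starting there; these
-- are the k - 1 wrapping intervals. Rank the intervals by their last positions (wrapping ones first).
-- At time t the lower boundary P of the diagram has height #{intervals ending before t} and the upper
-- boundary Q height k - 1 + #{intervals starting before t}; hence a North step of a path at time t and
-- height h lies in the interval of rank h mod r, and the North steps of a path form a partial
-- transversal of size r, i.e. a basis. Conversely a basis has r elements (by exchange against a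
-- rank-r independent set), and the path that goes North exactly at its elements, started at p (c + 1)
-- with c the number of wrapping intervals matched inside [start, n), stays between P and Q: counting
-- the matching before and after time t gives the two inequalities.

open import Defs
open import Data.Bool using (true; false)
open import Data.Empty using (⊥-elim)
open import Data.Fin using (Fin; zero; suc; toℕ; fromℕ<)
open import Data.Fin.Permutation using (Permutation′; _⟨$⟩ˡ_; inverseˡ)
open import Data.Fin.Properties using (any?; nonZeroIndex; ¬∀⟶∃¬; ¬∀⟶∃¬-smallest; toℕ-inject; pigeonhole; toℕ-fromℕ<; toℕ<n) renaming (_≟_ to _≟ᶠ_)
open import Data.Fin.Subset using (Subset; Side; ⁅_⁆; _∪_; ∣_∣) renaming (_∈_ to _∈ˢ_; _⊆_ to _⊆ˢ_)
open import Data.Fin.Subset.Properties using (_∈?_; x∈p∪q⁻; x∈p∪q⁺; x∈⁅x⁆; x∈⁅y⁆⇒x≡y; p⊆p∪q)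
open import Data.List using (List; []; _∷_; length; filter; upTo; allFin; _++_; [_]; tabulate)
open import Data.List.Properties using (length-++; length-upTo; length-tabulate; length-filter; upTo-∷ʳ; filter-++; filter-accept; filter-reject; filter-notAll; filter-none)
open import Data.List.Membership.Propositional using (_∈_)
open import Data.List.Membership.Propositional.Properties using (∈-filter⁺; ∈-filter⁻; ∈-upTo⁺; ∈-upTo⁻; ∈-allFin; ∈-++⁺ˡ; ∈-++⁺ʳ; ∈-++⁻)
import Data.List.Relation.Unary.All as All
import Data.List.Relation.Unary.Any as Any
open import Data.List.Relation.Unary.Any using (here; there)
open import Data.List.Relation.Unary.AllPairs using ([]; _∷_)
open import Data.List.Relation.Unary.Unique.Propositional using (Unique)
open import Data.List.Relation.Unary.Unique.Propositional.Properties using (allFin⁺; upTo⁺; filter⁺; ++⁺)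
open import Data.Nat using (ℕ; zero; suc; _≤′_; ≤′-refl; ≤′-step; _+_; _∸_; _*_; _≤_; _<_; z≤n; s≤s; NonZero; _%_; _/_; _≤?_; _<?_) renaming (_≟_ to _≟ℕ_)
open import Data.Nat.DivMod using (m%n<n; m≡m%n+[m/n]*n; m<n⇒m%n≡m; [m+n]%n≡m%n)
open import Data.Nat.Properties
open import Data.Nat.Tactic.RingSolver using (solve-∀)
open import Data.Product using (∃; _×_; _,_; proj₁; proj₂)
open import Data.Sum using (_⊎_; inj₁; inj₂)
open import Data.Unit using (tt)
open import Data.Vec using (Vec; []; _∷_; lookup)
open import Function.Bundles using (_⇔_; Equivalence; mk⇔)
open import Relation.Binary.Definitions using (DecidableEquality; tri<; tri≈; tri>)
open import Relation.Binary.PropositionalEquality using (_≡_; refl; sym; trans; cong; cong₂; subst; subst₂; module ≡-Reasoning)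
open import Relation.Nullary using (¬_; Dec; yes; no)
open import Relation.Nullary.Decidable using (¬?; _×-dec_)

-- Counting by injections

module _ {A B : Set} (_≟_ : DecidableEquality B) where

  length-≤-by-injectionᵈ : (xs : List A) (ys : List B) (f : ∀ a → a ∈ xs → B) → Unique xs →
    (∀ {a} (p : a ∈ xs) → f a p ∈ ys) →
    (∀ {a b} (p : a ∈ xs) (q : b ∈ xs) → f a p ≡ f b q → a ≡ b) →
    length xs ≤ length ys
  length-≤-by-injectionᵈ [] ys f _ _ _ = z≤n
  length-≤-by-injectionᵈ (a ∷ xs) ys f (a∉xs ∷ xs!) into inj =
    ≤-trans (s≤s rest) (filter-notAll (λ b → ¬? (fa ≟ b)) ys (Any.map (λ fa≡b fa≢b → fa≢b fa≡b) (into (here refl))))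
    where
    fa : B
    fa = f a (here refl)
    into-rest : ∀ {a′} (p : a′ ∈ xs) → f a′ (there p) ∈ filter (λ b → ¬? (fa ≟ b)) ys
    into-rest p = ∈-filter⁺ (λ b → ¬? (fa ≟ b)) (into (there p)) (λ e → All.lookup a∉xs p (inj (here refl) (there p) e))
    rest : length xs ≤ length (filter (λ b → ¬? (fa ≟ b)) ys)
    rest = length-≤-by-injectionᵈ xs _ (λ a′ p → f a′ (there p)) xs! into-rest (λ p q → inj (there p) (there q))

  length-≤-by-injection : (f : A → B) (xs : List A) (ys : List B) → Unique xs →
    (∀ {a} → a ∈ xs → f a ∈ ys) → (∀ {a b} → a ∈ xs → b ∈ xs → f a ≡ f b → a ≡ b) →
    length xs ≤ length ys
  length-≤-by-injection f xs ys = length-≤-by-injectionᵈ xs ys (λ a _ → f a)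

module _ {A : Set} {P : A → Set} (P? : ∀ a → Dec (P a)) where

  length-filter-partition : ∀ xs → length (filter P? xs) + length (filter (λ a → ¬? (P? a)) xs) ≡ length xs
  length-filter-partition [] = refl
  length-filter-partition (a ∷ xs) with P? a
  ... | yes _ = cong suc (length-filter-partition xs)
  ... | no _ = trans (+-suc _ _) (cong suc (length-filter-partition xs))

  length-filter-cong : ∀ {Q : A → Set} (Q? : ∀ a → Dec (Q a)) (xs : List A) →
    (∀ {a} → a ∈ xs → P a → Q a) → (∀ {a} → a ∈ xs → Q a → P a) →
    length (filter P? xs) ≡ length (filter Q? xs)
  length-filter-cong Q? [] _ _ = refl
  length-filter-cong Q? (a ∷ xs) pq qp with P? a | Q? a
  ... | yes _ | yes _ = cong suc (length-filter-cong Q? xs (λ m → pq (there m)) (λ m → qp (there m)))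
  ... | no _  | no _  = length-filter-cong Q? xs (λ m → pq (there m)) (λ m → qp (there m))
  ... | yes p | no ¬q = ⊥-elim (¬q (pq (here refl) p))
  ... | no ¬p | yes q = ⊥-elim (¬p (qp (here refl) q))

module _ {A : Set} {P Q : A → Set} (P? : ∀ a → Dec (P a)) (Q? : ∀ a → Dec (Q a)) where

  length-filter-× : ∀ xs → length (filter Q? (filter P? xs)) ≡ length (filter (λ a → P? a ×-dec Q? a) xs)
  length-filter-× [] = refl
  length-filter-× (a ∷ xs) with P? a
  ... | no _ = length-filter-× xs
  ... | yes _ with Q? a
  ...   | yes _ = cong suc (length-filter-× xs)
  ...   | no _ = length-filter-× xs

length-allFin : ∀ r → length (allFin r) ≡ r
length-allFin r = length-tabulate {n = r} (λ i → i)

# : ∀ {r} {P : Fin r → Set} → (∀ i → Dec (P i)) → ℕ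
# {r} P? = length (filter P? (allFin r))

module _ {r : ℕ} {P : Fin r → Set} (P? : ∀ i → Dec (P i)) where

  filter-allFin-Unique : Unique (filter P? (allFin r))
  filter-allFin-Unique = filter⁺ P? (allFin⁺ r)

  ∈-filter-allFin⁺ : ∀ {i} → P i → i ∈ filter P? (allFin r)
  ∈-filter-allFin⁺ {i} = ∈-filter⁺ P? (∈-allFin i)

  ∈-filter-allFin⁻ : ∀ {i} → i ∈ filter P? (allFin r) → P i
  ∈-filter-allFin⁻ i∈ = proj₂ (∈-filter⁻ P? {xs = allFin r} i∈)

  #≤r : # P? ≤ r
  #≤r = subst (# P? ≤_) (length-allFin r) (length-filter P? (allFin r))

  #<r : ∀ {i} → ¬ P i → # P? < r
  #<r {i} ¬p = subst (# P? <_) (length-allFin r) (filter-notAll P? (allFin r) (Any.map (λ { refl → ¬p }) (∈-allFin i)))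

  #+#∁≡r : # P? + # (λ i → ¬? (P? i)) ≡ r
  #+#∁≡r = trans (length-filter-partition P? (allFin r)) (length-allFin r)


#-mono : ∀ {r} {P Q : Fin r → Set} (P? : ∀ i → Dec (P i)) (Q? : ∀ i → Dec (Q i)) → (∀ {i} → P i → Q i) → # P? ≤ # Q?
#-mono {r} P? Q? p⇒q = length-≤-by-injection _≟ᶠ_ (λ i → i) (filter P? (allFin r)) (filter Q? (allFin r))
  (filter-allFin-Unique P?) (λ i∈ → ∈-filter-allFin⁺ Q? (p⇒q (∈-filter-allFin⁻ P? i∈))) (λ _ _ i≡j → i≡j)

module _ {P : ℕ → Set} (P? : ∀ t → Dec (P t)) where

  filter-upTo-Unique : ∀ d → Unique (filter P? (upTo d))
  filter-upTo-Unique d = filter⁺ P? (upTo⁺ d)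

  ∈-filter-upTo⁺ : ∀ {d t} → t < d → P t → t ∈ filter P? (upTo d)
  ∈-filter-upTo⁺ t<d = ∈-filter⁺ P? (∈-upTo⁺ t<d)

  ∈-filter-upTo⁻ : ∀ {d t} → t ∈ filter P? (upTo d) → t < d × P t
  ∈-filter-upTo⁻ {d} t∈ with ∈-filter⁻ P? {xs = upTo d} t∈
  ... | t∈upTo , p = ∈-upTo⁻ t∈upTo , p

  count : ℕ → ℕ
  count d = length (filter P? (upTo d))

  count-suc : ∀ d → count (suc d) ≡ count d + length (filter P? [ d ])
  count-suc d = begin
    length (filter P? (upTo (suc d)))              ≡⟨ cong (λ ts → length (filter P? ts)) (sym (upTo-∷ʳ d)) ⟩
    length (filter P? (upTo d ++ [ d ]))           ≡⟨ cong length (filter-++ P? (upTo d) [ d ]) ⟩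
    length (filter P? (upTo d) ++ filter P? [ d ]) ≡⟨ length-++ (filter P? (upTo d)) ⟩
    count d + length (filter P? [ d ])             ∎
    where open ≡-Reasoning

  count-suc-yes : ∀ {d} → P d → count (suc d) ≡ suc (count d)
  count-suc-yes {d} p = trans (count-suc d) (trans (cong (λ ts → count d + length ts) (filter-accept P? p)) (+-comm (count d) 1))

  count-suc-no : ∀ {d} → ¬ P d → count (suc d) ≡ count d
  count-suc-no {d} ¬p = trans (count-suc d) (trans (cong (λ ts → count d + length ts) (filter-reject P? ¬p)) (+-identityʳ (count d)))

  count-≤-suc : ∀ d → count d ≤ count (suc d)
  count-≤-suc d with P? d
  ... | yes p = ≤-trans (n≤1+n _) (≤-reflexive (sym (count-suc-yes p)))
  ... | no ¬p = ≤-reflexive (sym (count-suc-no ¬p))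

  count-mono : ∀ {d d′} → d ≤ d′ → count d ≤ count d′
  count-mono le = go (≤⇒≤′ le)
    where
    go : ∀ {d d′} → d ≤′ d′ → count d ≤ count d′
    go ≤′-refl = ≤-refl
    go (≤′-step le) = ≤-trans (go le) (count-≤-suc _)

  count-< : ∀ {t t′} → t < t′ → P t → count t < count t′
  count-< {t} t<t′ p = <-≤-trans (subst (count t <_) (sym (count-suc-yes p)) (n<1+n _)) (count-mono t<t′)

  count-injective : ∀ {t t′} → P t → P t′ → count t ≡ count t′ → t ≡ t′
  count-injective {t} {t′} p p′ eq with <-cmp t t′
  ... | tri≈ _ t≡t′ _ = t≡t′
  ... | tri< t<t′ _ _ = ⊥-elim (<-irrefl eq (count-< t<t′ p))
  ... | tri> _ _ t′<t = ⊥-elim (<-irrefl (sym eq) (count-< t′<t p′))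

  count-none : ∀ {d} → (∀ {t} → t < d → ¬ P t) → count d ≡ 0
  count-none none = cong length (filter-none P? (All.tabulate (λ t∈ → none (∈-upTo⁻ t∈))))

module _ {P : ℕ → Set} (P? : ∀ t → Dec (P t)) where

  from? : (d t : ℕ) → Dec (d ≤ t × P t)
  from? d t = (d ≤? t) ×-dec P? t

  count-split : ∀ {d d′} → d ≤ d′ → count P? d′ ≡ count P? d + count (from? d) d′
  count-split le = go (≤⇒≤′ le)
    where
    go : ∀ {d d′} → d ≤′ d′ → count P? d′ ≡ count P? d + count (from? d) d′
    go {d} ≤′-refl = sym (trans (cong (count P? d +_) (count-none (from? d) (λ t<d (d≤t , _) → <⇒≱ t<d d≤t))) (+-identityʳ _))
    go {d} (≤′-step {d′} le) with P? d′
    ... | yes p = begin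
      count P? (suc d′)                          ≡⟨ count-suc-yes P? p ⟩
      suc (count P? d′)                          ≡⟨ cong suc (go le) ⟩
      suc (count P? d + count (from? d) d′)      ≡⟨ sym (+-suc _ _) ⟩
      count P? d + suc (count (from? d) d′)      ≡⟨ cong (count P? d +_) (sym (count-suc-yes (from? d) (≤′⇒≤ le , p))) ⟩
      count P? d + count (from? d) (suc d′)      ∎
      where open ≡-Reasoning
    ... | no ¬p = trans (count-suc-no P? ¬p) (trans (go le) (cong (count P? d +_) (sym (count-suc-no (from? d) (λ q → ¬p (proj₂ q))))))

∸-<-of-<-+ : ∀ {a b c} → b ≤ a → a < b + c → a ∸ b < c
∸-<-of-<-+ {a} {b} {c} b≤a a<b+c = subst (a ∸ b <_) (m+n∸m≡n b c) (∸-monoˡ-< a<b+c b≤a)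

module _ {r : ℕ} .{{_ : NonZero r}} where

  %-cases : ∀ {a} → a < r + r → (a < r × a % r ≡ a) ⊎ (r ≤ a × a % r + r ≡ a)
  %-cases {a} a<2r with a <? r
  ... | yes a<r = inj₁ (a<r , m<n⇒m%n≡m a<r)
  ... | no a≮r = inj₂ (r≤a , (begin
    a % r + r              ≡⟨ cong (λ b → b % r + r) (sym (m∸n+n≡m r≤a)) ⟩
    (a ∸ r + r) % r + r    ≡⟨ cong (_+ r) ([m+n]%n≡m%n (a ∸ r) r) ⟩
    (a ∸ r) % r + r        ≡⟨ cong (_+ r) (m<n⇒m%n≡m (∸-<-of-<-+ r≤a a<2r)) ⟩
    a ∸ r + r              ≡⟨ m∸n+n≡m r≤a ⟩
    a                      ∎))
    where
    open ≡-Reasoning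
    r≤a : r ≤ a
    r≤a = ≮⇒≥ a≮r

  private
    %-apart : ∀ {c a b} → c ≤ a → b < c + r → a % r ≡ a → b % r + r ≡ b → ¬ a % r ≡ b % r
    %-apart {c} {a} {b} c≤a b<c+r a%≡a b%+r≡b eq = <⇒≱ b<c+r (begin
      c + r      ≤⟨ +-monoˡ-≤ r c≤a ⟩
      a + r      ≡⟨ cong (_+ r) (trans (sym a%≡a) eq) ⟩
      b % r + r  ≡⟨ b%+r≡b ⟩
      b          ∎)
      where open ≤-Reasoning

  %-injective-on-window : ∀ {c a b} → c ≤ r → c ≤ a → c ≤ b → a < c + r → b < c + r → a % r ≡ b % r → a ≡ b
  %-injective-on-window {c} {a} {b} c≤r c≤a c≤b a<c+r b<c+r eq
    with %-cases (<-≤-trans a<c+r (+-monoˡ-≤ r c≤r)) | %-cases (<-≤-trans b<c+r (+-monoˡ-≤ r c≤r))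
  ... | inj₁ (_ , a%≡a) | inj₁ (_ , b%≡b) = trans (sym a%≡a) (trans eq b%≡b)
  ... | inj₂ (_ , a%≡a) | inj₂ (_ , b%≡b) = trans (sym a%≡a) (trans (cong (_+ r) eq) b%≡b)
  ... | inj₁ (_ , a%≡a) | inj₂ (_ , b%≡b) = ⊥-elim (%-apart c≤a b<c+r a%≡a b%≡b eq)
  ... | inj₂ (_ , a%≡a) | inj₁ (_ , b%≡b) = ⊥-elim (%-apart c≤b a<c+r b%≡b a%≡a (sym eq))

-- The orbit of x under a cyclic permutation

iter-+ : ∀ {A : Set} (f : A → A) a b y → iter f (a + b) y ≡ iter f a (iter f b y)
iter-+ f zero b y = refl
iter-+ f (suc a) b y = cong f (iter-+ f a b y)

module Orbit {n : ℕ} (σ : Permutation′ n) (cyc : IsCyclic σ) (x : Fin n) where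

  instance
    n-nonZero : NonZero n
    n-nonZero = nonZeroIndex x

  ^-cancel : ∀ t {a b} → σ ^ t · a ≡ σ ^ t · b → a ≡ b
  ^-cancel zero e = e
  ^-cancel (suc t) {a} {b} e = ^-cancel t (trans (sym (inverseˡ σ)) (trans (cong (σ ⟨$⟩ˡ_) e) (inverseˡ σ)))

  ^-periodic-* : ∀ {p} → σ ^ p · x ≡ x → ∀ q → σ ^ (q * p) · x ≡ x
  ^-periodic-* e zero = refl
  ^-periodic-* {p} e (suc q) = trans (iter-+ _ p (q * p) x) (trans (cong (σ ^ p ·_) (^-periodic-* e q)) e)

  ^-periodic-% : ∀ {p} .{{_ : NonZero p}} → σ ^ p · x ≡ x → ∀ t → σ ^ t · x ≡ σ ^ (t % p) · x
  ^-periodic-% {p} e t = trans (cong (λ u → σ ^ u · x) (m≡m%n+[m/n]*n t p))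
    (trans (iter-+ _ (t % p) ((t / p) * p) x) (cong (σ ^ (t % p) ·_) (^-periodic-* e (t / p))))

  ^-return : ∀ {u t} → u ≤ t → σ ^ u · x ≡ σ ^ t · x → σ ^ (t ∸ u) · x ≡ x
  ^-return {u} {t} u≤t e = ^-cancel u (begin
    σ ^ u · (σ ^ (t ∸ u) · x) ≡⟨ sym (iter-+ _ u (t ∸ u) x) ⟩
    σ ^ (u + (t ∸ u)) · x     ≡⟨ cong (λ v → σ ^ v · x) (m+[n∸m]≡n u≤t) ⟩
    σ ^ t · x                 ≡⟨ sym e ⟩
    σ ^ u · x                 ∎)
    where open ≡-Reasoning

  -- Every point is σ^t x for some t < p, so t ↦ σ^t x maps [0, p) onto Fin n.
  period-≥ : ∀ {p} → 0 < p → σ ^ p · x ≡ x → n ≤ p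
  period-≥ {p@(suc _)} _ e = subst₂ _≤_ (length-allFin n) (length-upTo p)
    (length-≤-by-injection _≟ℕ_ exponent (allFin n) (upTo p) (allFin⁺ n) (λ {z} _ → ∈-upTo⁺ (m%n<n (proj₁ (cyc x z)) p)) exponent-injective)
    where
    exponent : Fin n → ℕ
    exponent z = proj₁ (cyc x z) % p
    exponent-injective : ∀ {a b} → a ∈ allFin n → b ∈ allFin n → exponent a ≡ exponent b → a ≡ b
    exponent-injective {a} {b} _ _ e′ = begin
      a                        ≡⟨ sym (proj₂ (cyc x a)) ⟩
      σ ^ proj₁ (cyc x a) · x  ≡⟨ ^-periodic-% e (proj₁ (cyc x a)) ⟩
      σ ^ exponent a · x       ≡⟨ cong (λ v → σ ^ v · x) e′ ⟩
      σ ^ exponent b · x       ≡⟨ sym (^-periodic-% e (proj₁ (cyc x b))) ⟩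
      σ ^ proj₁ (cyc x b) · x  ≡⟨ proj₂ (cyc x b) ⟩
      b                        ∎
      where open ≡-Reasoning

  orbit-injective : ∀ {u t} → u < n → t < n → σ ^ u · x ≡ σ ^ t · x → u ≡ t
  orbit-injective {u} {t} u<n t<n e with <-cmp u t
  ... | tri≈ _ u≡t _ = u≡t
  ... | tri< u<t _ _ = ⊥-elim (<⇒≱ (≤-<-trans (m∸n≤m t u) t<n) (period-≥ (m<n⇒0<n∸m u<t) (^-return (<⇒≤ u<t) e)))
  ... | tri> _ _ t<u = ⊥-elim (<⇒≱ (≤-<-trans (m∸n≤m u t) u<n) (period-≥ (m<n⇒0<n∸m t<u) (^-return (<⇒≤ t<u) (sym e))))

  -- By pigeonhole some σ^i x = σ^j x with i < j ≤ n; the period j - i is then exactly n.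
  ^-n : σ ^ n · x ≡ x
  ^-n with pigeonhole (n<1+n n) (λ (i : Fin (suc n)) → σ ^ toℕ i · x)
  ... | i , j , i<j , e = subst (λ q → σ ^ q · x ≡ x) (≤-antisym p≤n (period-≥ (m<n⇒0<n∸m i<j) returns)) returns
    where
    returns : σ ^ (toℕ j ∸ toℕ i) · x ≡ x
    returns = ^-return (<⇒≤ i<j) e
    p≤n : toℕ j ∸ toℕ i ≤ n
    p≤n = ≤-trans (m∸n≤m (toℕ j) (toℕ i)) (≤-pred (toℕ<n j))

  ^-+n : ∀ u → σ ^ (u + n) · x ≡ σ ^ u · x
  ^-+n u = trans (iter-+ _ u n x) (cong (σ ^ u ·_) ^-n)

  pos : Fin n → ℕ
  pos z = proj₁ (cyc x z) % n

  pos<n : ∀ z → pos z < n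
  pos<n z = m%n<n (proj₁ (cyc x z)) n

  ^-pos : ∀ z → σ ^ pos z · x ≡ z
  ^-pos z = trans (sym (^-periodic-% ^-n (proj₁ (cyc x z)))) (proj₂ (cyc x z))

  pos-^ : ∀ {t} → t < n → pos (σ ^ t · x) ≡ t
  pos-^ t<n = orbit-injective (pos<n _) t<n (^-pos _)

  pos-injective : ∀ {a b} → pos a ≡ pos b → a ≡ b
  pos-injective {a} {b} e = trans (sym (^-pos a)) (trans (cong (λ v → σ ^ v · x) e) (^-pos b))

  0<n : 0 < n
  0<n = ≤-trans (s≤s z≤n) (toℕ<n x)

  pos-x : pos x ≡ 0
  pos-x = pos-^ 0<n

  pos-^-wrap : ∀ {u} → n ≤ u → u < n + n → pos (σ ^ u · x) + n ≡ u
  pos-^-wrap {u} n≤u u<2n = begin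
    pos (σ ^ u · x) + n           ≡⟨ cong (λ v → pos (σ ^ v · x) + n) (sym (m∸n+n≡m n≤u)) ⟩
    pos (σ ^ (u ∸ n + n) · x) + n ≡⟨ cong (λ z → pos z + n) (^-+n (u ∸ n)) ⟩
    pos (σ ^ (u ∸ n) · x) + n     ≡⟨ cong (_+ n) (pos-^ (∸-<-of-<-+ n≤u u<2n)) ⟩
    u ∸ n + n                     ≡⟨ m∸n+n≡m n≤u ⟩
    u                             ∎
    where open ≡-Reasoning

  -- An interval occupies the positions [start, end) of the orbit of x, read modulo n:
  -- it contains x without starting at x exactly when end exceeds n.
  start : Interval n → ℕ
  start I = pos (first I)

  end : Interval n → ℕ
  end I = start I + len I

  InWindow : Interval n → ℕ → Set
  InWindow I t = (start I ≤ t × t < end I) ⊎ (t + n < end I)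

  Wraps : Interval n → Set
  Wraps I = n < end I

  end<2n : ∀ I → end I < n + n
  end<2n I = +-mono-<-≤ (pos<n (first I)) (len-≤ I)

  ^-from-start : ∀ I j → σ ^ j · first I ≡ σ ^ (j + start I) · x
  ^-from-start I j = sym (trans (iter-+ _ j (start I) x) (cong (σ ^ j ·_) (^-pos (first I))))

  inWindow-pos-^ : ∀ I {u} → start I ≤ u → u < end I → InWindow I (pos (σ ^ u · x))
  inWindow-pos-^ I {u} s≤u u<e with u <? n
  ... | yes u<n = inj₁ (subst (λ t → start I ≤ t × t < end I) (sym (pos-^ u<n)) (s≤u , u<e))
  ... | no u≮n = inj₂ (subst (_< end I) (sym (pos-^-wrap (≮⇒≥ u≮n) (<-trans u<e (end<2n I)))) u<e)

  elem-from-window : ∀ I {u y} → start I ≤ u → u < end I → σ ^ u · x ≡ y → Elem σ I y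
  elem-from-window I {u} s≤u u<e e = fromℕ< j<len , (begin
    σ ^ toℕ (fromℕ< j<len) · first I ≡⟨ cong (λ v → σ ^ v · first I) (toℕ-fromℕ< j<len) ⟩
    σ ^ (u ∸ start I) · first I      ≡⟨ ^-from-start I (u ∸ start I) ⟩
    σ ^ (u ∸ start I + start I) · x  ≡⟨ cong (λ v → σ ^ v · x) (m∸n+n≡m s≤u) ⟩
    σ ^ u · x                        ≡⟨ e ⟩
    _                                ∎)
    where
    open ≡-Reasoning
    j<len : u ∸ start I < len I
    j<len = ∸-<-of-<-+ s≤u u<e

  elem⇒inWindow : ∀ I {y} → Elem σ I y → InWindow I (pos y)
  elem⇒inWindow I (j , refl) rewrite ^-from-start I (toℕ j) =
    inWindow-pos-^ I (m≤n+m _ _) (subst (toℕ j + start I <_) (+-comm (len I) (start I)) (+-monoˡ-< (start I) (toℕ<n j)))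

  inWindow⇒elem : ∀ I y → InWindow I (pos y) → Elem σ I y
  inWindow⇒elem I y (inj₁ (s≤t , t<e)) = elem-from-window I s≤t t<e (^-pos y)
  inWindow⇒elem I y (inj₂ t+n<e) = elem-from-window I s≤t+n t+n<e (trans (^-+n (pos y)) (^-pos y))
    where
    s≤t+n : start I ≤ pos y + n
    s≤t+n = ≤-trans (<⇒≤ (pos<n (first I))) (m≤n+m n (pos y))

  lastPos : Interval n → ℕ
  lastPos I = pos (lastElem σ I)

  private
    lastExponent : Interval n → ℕ
    lastExponent I = len I ∸ 1 + start I

    suc-lastExponent : ∀ I → suc (lastExponent I) ≡ end I
    suc-lastExponent I = trans (cong (_+ start I) (trans (+-comm 1 (len I ∸ 1)) (m∸n+n≡m (len-pos I)))) (+-comm (len I) (start I))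

    lastElem-^ : ∀ I → lastElem σ I ≡ σ ^ lastExponent I · x
    lastElem-^ I = ^-from-start I (len I ∸ 1)

  suc-lastPos : ∀ I → ¬ Wraps I → suc (lastPos I) ≡ end I
  suc-lastPos I ¬wraps = begin
    suc (lastPos I)                      ≡⟨ cong (λ z → suc (pos z)) (lastElem-^ I) ⟩
    suc (pos (σ ^ lastExponent I · x))   ≡⟨ cong suc (pos-^ (subst (_≤ n) (sym (suc-lastExponent I)) (≮⇒≥ ¬wraps))) ⟩
    suc (lastExponent I)                 ≡⟨ suc-lastExponent I ⟩
    end I                                ∎
    where open ≡-Reasoning

  suc-lastPos-wrap : ∀ I → Wraps I → suc (lastPos I) + n ≡ end I
  suc-lastPos-wrap I wraps = begin
    suc (lastPos I) + n                   ≡⟨ cong (λ z → suc (pos z + n)) (lastElem-^ I) ⟩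
    suc (pos (σ ^ lastExponent I · x) + n) ≡⟨ cong suc (pos-^-wrap n≤u u<2n) ⟩
    suc (lastExponent I)                  ≡⟨ suc-lastExponent I ⟩
    end I                                 ∎
    where
    open ≡-Reasoning
    n≤u : n ≤ lastExponent I
    n≤u = ≤-pred (subst (n <_) (sym (suc-lastExponent I)) wraps)
    u<2n : lastExponent I < n + n
    u<2n = <-trans (subst (lastExponent I <_) (suc-lastExponent I) (n<1+n _)) (end<2n I)

  wraps⇔ : ∀ I → (Elem σ I x × ¬ x ≡ first I) ⇔ Wraps I
  wraps⇔ I = mk⇔ to from
    where
    to : Elem σ I x × ¬ x ≡ first I → Wraps I
    to (x∈I , x≢first) with elem⇒inWindow I x∈I
    ... | inj₂ p = subst (λ t → t + n < end I) pos-x p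
    ... | inj₁ (s≤0 , _) = ⊥-elim (x≢first (pos-injective (trans pos-x (sym (n≤0⇒n≡0 (subst (start I ≤_) pos-x s≤0))))))
    from : Wraps I → Elem σ I x × ¬ x ≡ first I
    from wraps = inWindow⇒elem I x (inj₂ (subst (λ t → t + n < end I) (sym pos-x) wraps)) , x≢first
      where
      x≢first : ¬ x ≡ first I
      x≢first x≡f = <⇒≱ wraps (subst (_≤ n) (cong (_+ len I) (sym (trans (cong pos (sym x≡f)) pos-x))) (len-≤ I))

-- Transversal matroids of interval families

size : ∀ {n} → Subset n → ℕ
size {n} B = length (filter (_∈? B) (allFin n))

length-filter-∈?-suc : ∀ {q q′} (b : Side) (B : Subset q) (f : Fin q′ → Fin q) →
  length (filter (_∈? (b ∷ B)) (tabulate (λ i → suc (f i)))) ≡ length (filter (_∈? B) (tabulate f))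
length-filter-∈?-suc {q′ = zero} b B f = refl
length-filter-∈?-suc {q′ = suc q′} b B f with f zero ∈? B
... | yes _ = cong suc (length-filter-∈?-suc b B (λ i → f (suc i)))
... | no _ = length-filter-∈?-suc b B (λ i → f (suc i))

∣∣≡size : ∀ {n} (B : Subset n) → ∣ B ∣ ≡ size B
∣∣≡size [] = refl
∣∣≡size (true ∷ B) = cong suc (trans (∣∣≡size B) (sym (length-filter-∈?-suc true B (λ i → i))))
∣∣≡size (false ∷ B) = trans (∣∣≡size B) (sym (length-filter-∈?-suc false B (λ i → i)))

module Transversal {n r : ℕ} (σ : Permutation′ n) (𝓘 : Fin r → Interval n) where

  IsMatching : Subset n → (Fin n → Fin r) → Set
  IsMatching B φ = (∀ y → y ∈ˢ B → Elem σ (𝓘 (φ y)) y) × (∀ y z → y ∈ˢ B → z ∈ˢ B → φ y ≡ φ z → y ≡ z)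

  private
    ∈-filter-∈?⁻ : ∀ {B : Subset n} {y} → y ∈ filter (_∈? B) (allFin n) → y ∈ˢ B
    ∈-filter-∈?⁻ {B} y∈ = proj₂ (∈-filter⁻ (_∈? B) {xs = allFin n} y∈)

  size-≤-of-matching : ∀ {B φ} → IsMatching B φ → size B ≤ r
  size-≤-of-matching {B} {φ} (_ , φ-injective) = subst (size B ≤_) (length-allFin r)
    (length-≤-by-injection _≟ᶠ_ φ (filter (_∈? B) (allFin n)) (allFin r) (filter⁺ (_∈? B) (allFin⁺ n))
      (λ _ → ∈-allFin _) (λ y∈ z∈ → φ-injective _ _ (∈-filter-∈?⁻ y∈) (∈-filter-∈?⁻ z∈)))

  maximal-of-size : ∀ {B} → size B ≡ r → ∀ B′ → Independent σ 𝓘 B′ → B ⊆ˢ B′ → B′ ⊆ˢ B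
  maximal-of-size {B} size-B B′ (φ′ , _ , φ′-injective) B⊆B′ {y} y∈B′ with y ∈? B
  ... | yes y∈B = y∈B
  ... | no y∉B = ⊥-elim (<-irrefl refl (subst₂ _≤_ (cong suc size-B) (length-allFin r)
    (length-≤-by-injection _≟ᶠ_ φ′ (y ∷ filter (_∈? B) (allFin n)) (allFin r)
      (All.tabulate (λ z∈ y≡z → y∉B (subst (_∈ˢ B) (sym y≡z) (∈-filter-∈?⁻ z∈))) ∷ filter⁺ (_∈? B) (allFin⁺ n))
      (λ _ → ∈-allFin _) (λ a∈ b∈ → φ′-injective _ _ (in-B′ a∈) (in-B′ b∈)))))
    where
    in-B′ : ∀ {a} → a ∈ y ∷ filter (_∈? B) (allFin n) → a ∈ˢ B′
    in-B′ (here refl) = y∈B′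
    in-B′ (there a∈) = B⊆B′ (∈-filter-∈?⁻ a∈)

  matching-onto : ∀ {A ψ} → IsMatching A ψ → size A ≡ r → ∀ J → ∃ λ a → a ∈ˢ A × ψ a ≡ J
  matching-onto {A} {ψ} (_ , ψ-injective) size-A J with any? (λ a → (a ∈? A) ×-dec (ψ a ≟ᶠ J))
  ... | yes hit = hit
  ... | no miss = ⊥-elim (<-irrefl refl (begin-strict
    r                                  ≡⟨ sym size-A ⟩
    size A                             ≤⟨ into-others ⟩
    length (filter ≢J? (allFin r))     <⟨ filter-notAll ≢J? (allFin r) (Any.map (λ { refl ¬≢ → ¬≢ refl }) (∈-allFin J)) ⟩
    length (allFin r)                  ≡⟨ length-allFin r ⟩
    r                                  ∎))
    where
    open ≤-Reasoning
    ≢J? : ∀ J′ → Dec (¬ J′ ≡ J)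
    ≢J? J′ = ¬? (J′ ≟ᶠ J)
    into-others : size A ≤ length (filter ≢J? (allFin r))
    into-others = length-≤-by-injection _≟ᶠ_ ψ (filter (_∈? A) (allFin n)) (filter ≢J? (allFin r)) (filter⁺ (_∈? A) (allFin⁺ n))
      (λ {a} a∈ → ∈-filter⁺ ≢J? (∈-allFin _) (λ ψa≡J → miss (a , ∈-filter-∈?⁻ a∈ , ψa≡J)))
      (λ a∈ b∈ → ψ-injective _ _ (∈-filter-∈?⁻ a∈) (∈-filter-∈?⁻ b∈))

  unmatched : ∀ {B φ} → size B < r → ∃ λ J → ∀ y → y ∈ˢ B → ¬ φ y ≡ J
  unmatched {B} {φ} size-B<r with ¬∀⟶∃¬ r Hit (λ J → any? (λ y → (y ∈? B) ×-dec (φ y ≟ᶠ J))) ¬all-hit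
    where
    Hit : Fin r → Set
    Hit J = ∃ λ y → y ∈ˢ B × φ y ≡ J
    ¬all-hit : ¬ (∀ J → Hit J)
    ¬all-hit hit = <⇒≱ size-B<r (subst (_≤ size B) (length-allFin r)
      (length-≤-by-injection _≟ᶠ_ (λ J → proj₁ (hit J)) (allFin r) (filter (_∈? B) (allFin n)) (allFin⁺ r)
        (λ {J} _ → ∈-filter⁺ (_∈? B) (∈-allFin _) (proj₁ (proj₂ (hit J))))
        (λ {J} {J′} _ _ eq → trans (sym (proj₂ (proj₂ (hit J)))) (trans (cong φ eq) (proj₂ (proj₂ (hit J′)))))))
  ... | J , ¬hit = J , λ y y∈B φy≡J → ¬hit (y , y∈B , φy≡J)

  -- Follow the alternating path J₀, a₀, J₁ = φ a₀, a₁, … with ψ aₜ = Jₜ until it leaves B;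
  -- rematching a₀ … a_j along ψ frees room for a_j.
  module Augment {B A : Subset n} {φ ψ : Fin n → Fin r} (φ-matching : IsMatching B φ) (ψ-matching : IsMatching A ψ)
      (ψ-onto : ∀ J → ∃ λ a → a ∈ˢ A × ψ a ≡ J) (J₀ : Fin r) (J₀-free : ∀ y → y ∈ˢ B → ¬ φ y ≡ J₀) where

    chain : ℕ → Fin r
    alt : ℕ → Fin n
    chain zero = J₀
    chain (suc t) = φ (alt t)
    alt t = proj₁ (ψ-onto (chain t))

    alt∈A : ∀ t → alt t ∈ˢ A
    alt∈A t = proj₁ (proj₂ (ψ-onto (chain t)))

    ψ-alt : ∀ t → ψ (alt t) ≡ chain t
    ψ-alt t = proj₂ (proj₂ (ψ-onto (chain t)))

    chain-distinct : ∀ {u v} → u < v → (∀ t → t < v → alt t ∈ˢ B) → ¬ chain u ≡ chain v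
    chain-distinct {zero} {suc v} _ in-B eq = J₀-free (alt v) (in-B v ≤-refl) (sym eq)
    chain-distinct {suc u} {suc v} (s≤s u<v) in-B eq = chain-distinct u<v (λ t t<v → in-B t (m≤n⇒m≤1+n t<v))
      (trans (sym (ψ-alt u)) (trans (cong ψ (proj₂ φ-matching _ _ (in-B u (s≤s (<⇒≤ u<v))) (in-B v ≤-refl) eq)) (ψ-alt v)))

    leaves-B : ∃ λ j → ¬ alt j ∈ˢ B × (∀ t → t < j → alt t ∈ˢ B)
    leaves-B with ¬∀⟶∃¬-smallest (suc r) (λ f → alt (toℕ f) ∈ˢ B) (λ f → alt (toℕ f) ∈? B) ¬always-in-B
      where
      ¬always-in-B : ¬ (∀ (f : Fin (suc r)) → alt (toℕ f) ∈ˢ B)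
      ¬always-in-B in-B with pigeonhole (n<1+n r) (λ f → chain (toℕ f))
      ... | f , f′ , f<f′ , eq = chain-distinct f<f′ (λ t t<f′ → subst (_∈ˢ B) (cong alt (toℕ-fromℕ< (<-trans t<f′ (toℕ<n f′))))
                                                              (in-B (fromℕ< (<-trans t<f′ (toℕ<n f′))))) eq
    ... | f , ∉B , before-in-B = toℕ f , ∉B , λ t t<f →
      subst (_∈ˢ B) (cong alt (trans (toℕ-inject (fromℕ< t<f)) (toℕ-fromℕ< t<f))) (before-in-B (fromℕ< t<f))

    j : ℕ
    j = proj₁ leaves-B

    OnPath : Fin n → Set
    OnPath y = ∃ λ (f : Fin (suc j)) → alt (toℕ f) ≡ y

    φ′ : Fin n → Fin r
    φ′ y with any? (λ (f : Fin (suc j)) → alt (toℕ f) ≟ᶠ y)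
    ... | yes _ = ψ y
    ... | no _ = φ y

    off-path∈B : ∀ {y} → y ∈ˢ B ∪ ⁅ alt j ⁆ → ¬ OnPath y → y ∈ˢ B
    off-path∈B {y} y∈ off with x∈p∪q⁻ B ⁅ alt j ⁆ y∈
    ... | inj₁ y∈B = y∈B
    ... | inj₂ y∈⁅⁆ = ⊥-elim (off (fromℕ< (n<1+n j) , trans (cong alt (toℕ-fromℕ< (n<1+n j))) (sym (x∈⁅y⁆⇒x≡y (alt j) y∈⁅⁆))))

    on-path∈A : ∀ {y} → OnPath y → y ∈ˢ A
    on-path∈A (f , refl) = alt∈A (toℕ f)

    -- An on-path ψ-partner is some Jₜ with t ≤ j, which is φ-matched only to aₜ₋₁, itself on the path.
    ψ≢φ-off-path : ∀ {y z} → OnPath y → ¬ OnPath z → z ∈ˢ B → ¬ ψ y ≡ φ z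
    ψ≢φ-off-path {y} {z} (f , refl) off z∈B eq = go (toℕ f) (toℕ<n f) (trans (sym (ψ-alt (toℕ f))) eq)
      where
      go : ∀ t → t < suc j → ¬ chain t ≡ φ z
      go zero _ J₀≡φz = J₀-free z z∈B (sym J₀≡φz)
      go (suc t) (s≤s t<j) φat≡φz = off (fromℕ< (s≤s (<⇒≤ t<j)) ,
        trans (cong alt (toℕ-fromℕ< (s≤s (<⇒≤ t<j)))) (proj₂ φ-matching _ _ (proj₂ (proj₂ leaves-B) t t<j) z∈B φat≡φz))

    augmented : IsMatching (B ∪ ⁅ alt j ⁆) φ′
    augmented = elem , injective
      where
      elem : ∀ y → y ∈ˢ B ∪ ⁅ alt j ⁆ → Elem σ (𝓘 (φ′ y)) y
      elem y y∈ with any? (λ (f : Fin (suc j)) → alt (toℕ f) ≟ᶠ y)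
      ... | yes on = proj₁ ψ-matching y (on-path∈A on)
      ... | no off = proj₁ φ-matching y (off-path∈B y∈ off)
      injective : ∀ y z → y ∈ˢ B ∪ ⁅ alt j ⁆ → z ∈ˢ B ∪ ⁅ alt j ⁆ → φ′ y ≡ φ′ z → y ≡ z
      injective y z y∈ z∈ eq with any? (λ (f : Fin (suc j)) → alt (toℕ f) ≟ᶠ y) | any? (λ (f : Fin (suc j)) → alt (toℕ f) ≟ᶠ z)
      ... | yes on-y | yes on-z = proj₂ ψ-matching y z (on-path∈A on-y) (on-path∈A on-z) eq
      ... | no off-y | no off-z = proj₂ φ-matching y z (off-path∈B y∈ off-y) (off-path∈B z∈ off-z) eq
      ... | yes on-y | no off-z = ⊥-elim (ψ≢φ-off-path on-y off-z (off-path∈B z∈ off-z) eq)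
      ... | no off-y | yes on-z = ⊥-elim (ψ≢φ-off-path on-z off-y (off-path∈B y∈ off-y) (sym eq))

  augment : ∀ {B A} → Independent σ 𝓘 B → Independent σ 𝓘 A → size A ≡ r → size B < r →
    ∃ λ y → ¬ y ∈ˢ B × Independent σ 𝓘 (B ∪ ⁅ y ⁆)
  augment (φ , φ-matching) (ψ , ψ-matching) size-A size-B<r with unmatched size-B<r
  ... | J₀ , J₀-free = alt j , proj₁ (proj₂ leaves-B) , φ′ , augmented
    where open Augment φ-matching ψ-matching (matching-onto ψ-matching size-A) J₀ J₀-free

  size-basis : ∀ {B A} → IsBasis σ 𝓘 B → Independent σ 𝓘 A → size A ≡ r → size B ≡ r
  size-basis {B} ((φ , φ-matching) , maximal) A-independent size-A = ≤-antisym (size-≤-of-matching φ-matching) (≮⇒≥ size-B≮r)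
    where
    size-B≮r : ¬ size B < r
    size-B≮r size-B<r = y∉B (maximal (B ∪ ⁅ y ⁆) independent (p⊆p∪q ⁅ y ⁆) (x∈p∪q⁺ (inj₂ (x∈⁅x⁆ y))))
      where
      augmented : ∃ λ y → ¬ y ∈ˢ B × Independent σ 𝓘 (B ∪ ⁅ y ⁆)
      augmented = augment (φ , φ-matching) A-independent size-A size-B<r
      y : Fin n
      y = proj₁ augmented
      y∉B : ¬ y ∈ˢ B
      y∉B = proj₁ (proj₂ augmented)
      independent : Independent σ 𝓘 (B ∪ ⁅ y ⁆)
      independent = proj₂ (proj₂ augmented)

module _ {A : Set} where

  steps : (ℕ → A) → (o len : ℕ) → Vec A len
  steps g o zero = []
  steps g o (suc len) = g o ∷ steps g (suc o) len

  lookup-steps : ∀ g o len (f : Fin len) → lookup (steps g o len) f ≡ g (o + toℕ f)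
  lookup-steps g o (suc len) zero = cong g (sym (+-identityʳ o))
  lookup-steps g o (suc len) (suc f) = trans (lookup-steps g (suc o) len f) (cong g (sym (+-suc o (toℕ f))))

  lookupᴺ : ∀ {len} → A → Vec A len → ℕ → A
  lookupᴺ default [] _ = default
  lookupᴺ default (a ∷ as) zero = a
  lookupᴺ default (a ∷ as) (suc t) = lookupᴺ default as t

  lookup≡lookupᴺ : ∀ {len} default (as : Vec A len) (f : Fin len) → lookup as f ≡ lookupᴺ default as (toℕ f)
  lookup≡lookupᴺ default (a ∷ as) zero = refl
  lookup≡lookupᴺ default (a ∷ as) (suc f) = lookup≡lookupᴺ default as f

  steps-lookupᴺ : ∀ {len} default (as : Vec A len) → steps (lookupᴺ default as) 0 len ≡ as
  steps-lookupᴺ default [] = refl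
  steps-lookupᴺ default (a ∷ as) = cong (a ∷_) (trans (shift (lookupᴺ default (a ∷ as)) 0 _) (steps-lookupᴺ default as))
    where
    shift : ∀ g o len → steps g (suc o) len ≡ steps (λ t → g (suc t)) o len
    shift g o zero = refl
    shift g o (suc len) = cong (g (suc o) ∷_) (shift g (suc o) len)

-- Multi-path presentations and their diagrams

module Presentation (m r : ℕ) (σ : Permutation′ (m + r)) (cyc : IsCyclic σ)
    (𝓘 : Fin r → Interval (m + r)) (anti : Antichain σ 𝓘) (x : Fin (m + r)) where

  n : ℕ
  n = m + r

  open Orbit σ cyc x public
  open Transversal σ 𝓘

  s e l : Fin r → ℕ
  s i = start (𝓘 i)
  e i = end (𝓘 i)
  l i = lastPos (𝓘 i)

  Wr : Fin r → Set
  Wr i = Wraps (𝓘 i)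

  Wr? : ∀ i → Dec (Wr i)
  Wr? i = n <? e i

  ¬Wr? : ∀ i → Dec (¬ Wr i)
  ¬Wr? i = ¬? (Wr? i)

  _⊆ᴵ_ : Fin r → Fin r → Set
  i ⊆ᴵ j = ∀ y → Elem σ (𝓘 i) y → Elem σ (𝓘 j) y

  ⊆ᴵ-of-window : ∀ i j → (∀ t → InWindow (𝓘 i) t → InWindow (𝓘 j) t) → i ⊆ᴵ j
  ⊆ᴵ-of-window i j h y y∈ = inWindow⇒elem (𝓘 j) y (h (pos y) (elem⇒inWindow (𝓘 i) y∈))

  ⊆ᴵ-nested : ∀ i j → s j ≤ s i → e i ≤ e j → i ⊆ᴵ j
  ⊆ᴵ-nested i j sj≤si ei≤ej = ⊆ᴵ-of-window i j λ
    { t (inj₁ (si≤t , t<ei)) → inj₁ (≤-trans sj≤si si≤t , <-≤-trans t<ei ei≤ej)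
    ; t (inj₂ t+n<ei) → inj₂ (<-≤-trans t+n<ei ei≤ej) }

  ⊆ᴵ-shifted : ∀ i j → e i + n ≤ e j → i ⊆ᴵ j
  ⊆ᴵ-shifted i j ei+n≤ej = ⊆ᴵ-of-window i j λ
    { t (inj₁ (_ , t<ei)) → inj₂ (<-≤-trans (+-monoˡ-< n t<ei) ei+n≤ej)
    ; t (inj₂ t+n<ei) → inj₂ (<-≤-trans t+n<ei (≤-trans (m≤m+n (e i) n) ei+n≤ej)) }

  ⊆ᴵ⇒≡ : ∀ {i j} → i ⊆ᴵ j → i ≡ j
  ⊆ᴵ⇒≡ {i} {j} i⊆j with i ≟ᶠ j
  ... | yes i≡j = i≡j
  ... | no i≢j = ⊥-elim (anti i j i≢j i⊆j)

  s-injective : ∀ {i j} → s i ≡ s j → i ≡ j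
  s-injective {i} {j} si≡sj with ≤-total (len (𝓘 i)) (len (𝓘 j))
  ... | inj₁ ≤len = ⊆ᴵ⇒≡ (⊆ᴵ-nested i j (≤-reflexive (sym si≡sj)) (+-mono-≤ (≤-reflexive si≡sj) ≤len))
  ... | inj₂ ≥len = sym (⊆ᴵ⇒≡ (⊆ᴵ-nested j i (≤-reflexive si≡sj) (+-mono-≤ (≤-reflexive (sym si≡sj)) ≥len)))

  e-injective : ∀ {i j} → e i ≡ e j → i ≡ j
  e-injective {i} {j} ei≡ej with ≤-total (s i) (s j)
  ... | inj₁ si≤sj = sym (⊆ᴵ⇒≡ (⊆ᴵ-nested j i si≤sj (≤-reflexive (sym ei≡ej))))
  ... | inj₂ sj≤si = ⊆ᴵ⇒≡ (⊆ᴵ-nested i j sj≤si (≤-reflexive ei≡ej))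

  suc-l : ∀ {i} → ¬ Wr i → suc (l i) ≡ e i
  suc-l {i} = suc-lastPos (𝓘 i)

  suc-l-wrap : ∀ {i} → Wr i → suc (l i) + n ≡ e i
  suc-l-wrap {i} = suc-lastPos-wrap (𝓘 i)

  l-injective : ∀ {i j} → l i ≡ l j → i ≡ j
  l-injective {i} {j} li≡lj with Wr? i | Wr? j
  ... | yes wi | yes wj = e-injective (trans (sym (suc-l-wrap wi)) (trans (cong (λ t → suc t + n) li≡lj) (suc-l-wrap wj)))
  ... | no ¬wi | no ¬wj = e-injective (trans (sym (suc-l ¬wi)) (trans (cong suc li≡lj) (suc-l ¬wj)))
  ... | yes wi | no ¬wj = sym (⊆ᴵ⇒≡ (⊆ᴵ-shifted j i
    (≤-reflexive (trans (cong (_+ n) (trans (sym (suc-l ¬wj)) (cong suc (sym li≡lj)))) (suc-l-wrap wi)))))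
  ... | no ¬wi | yes wj = ⊆ᴵ⇒≡ (⊆ᴵ-shifted i j
    (≤-reflexive (trans (cong (_+ n) (trans (sym (suc-l ¬wi)) (cong suc li≡lj))) (suc-l-wrap wj))))

  l-<-wrapping : ∀ {i j} → Wr i → ¬ Wr j → l i < l j
  l-<-wrapping {i} {j} wi ¬wj with l i <? l j
  ... | yes li<lj = li<lj
  ... | no li≮lj = ⊥-elim (¬wj (subst Wr (sym (⊆ᴵ⇒≡ (⊆ᴵ-shifted j i ej+n≤ei))) wi))
    where
    ej+n≤ei : e j + n ≤ e i
    ej+n≤ei = subst₂ _≤_ (cong (_+ n) (suc-l ¬wj)) (suc-l-wrap wi) (+-monoˡ-≤ n (s≤s (≮⇒≥ li≮lj)))

  ¬Wr-of-s-< : ∀ {i j} → ¬ Wr j → s i < s j → ¬ Wr i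
  ¬Wr-of-s-< {i} {j} ¬wj si<sj wi = <-irrefl (cong s (sym (⊆ᴵ⇒≡ (⊆ᴵ-nested j i (<⇒≤ si<sj) (≤-trans (≮⇒≥ ¬wj) (<⇒≤ wi)))))) si<sj

  l-<-of-s-< : ∀ {i j} → (Wr i → Wr j) → (Wr j → Wr i) → s i < s j → l i < l j
  l-<-of-s-< {i} {j} wi⇒wj wj⇒wi si<sj with l i <? l j
  ... | yes li<lj = li<lj
  ... | no li≮lj = ⊥-elim (<-irrefl (cong s (sym (⊆ᴵ⇒≡ (⊆ᴵ-nested j i (<⇒≤ si<sj) ej≤ei)))) si<sj)
    where
    ej≤ei : e j ≤ e i
    ej≤ei with Wr? j
    ... | yes wj = subst₂ _≤_ (suc-l-wrap wj) (suc-l-wrap (wj⇒wi wj)) (+-monoˡ-≤ n (s≤s (≮⇒≥ li≮lj)))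
    ... | no ¬wj = subst₂ _≤_ (suc-l ¬wj) (suc-l (λ wi → ¬wj (wi⇒wj wi))) (s≤s (≮⇒≥ li≮lj))

  s<? : ∀ t i → Dec (s i < t)
  s<? t i = s i <? t

  l<? : ∀ t i → Dec (l i < t)
  l<? t i = l i <? t

  l≮? : ∀ t i → Dec (¬ l i < t)
  l≮? t i = ¬? (l<? t i)

  count-image : (h : Fin r → Fin n) → (∀ {i j} → h i ≡ h j → i ≡ j) → ∀ {t} → t ≤ n →
    count (λ u → any? (λ i → h i ≟ᶠ σ ^ u · x)) t ≡ # (λ i → pos (h i) <? t)
  count-image h h-injective {t} t≤n = ≤-antisym image→index index→image
    where
    H? : ∀ u → Dec (∃ λ i → h i ≡ σ ^ u · x)
    H? u = any? (λ i → h i ≟ᶠ σ ^ u · x)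
    L? : ∀ i → Dec (pos (h i) < t)
    L? i = pos (h i) <? t
    module _ {u} (u∈ : u ∈ filter H? (upTo t)) where
      u<t : u < t
      u<t = proj₁ (∈-filter-upTo⁻ H? {t} u∈)
      index : Fin r
      index = proj₁ (proj₂ (∈-filter-upTo⁻ H? {t} u∈))
      h-index : h index ≡ σ ^ u · x
      h-index = proj₂ (proj₂ (∈-filter-upTo⁻ H? {t} u∈))
      pos-h-index : pos (h index) ≡ u
      pos-h-index = trans (cong pos h-index) (pos-^ (<-≤-trans u<t t≤n))
    image→index : count H? t ≤ # L?
    image→index = length-≤-by-injectionᵈ _≟ᶠ_ (filter H? (upTo t)) (filter L? (allFin r)) (λ _ → index)
      (filter-upTo-Unique H? t)
      (λ u∈ → ∈-filter-allFin⁺ L? (subst (_< t) (sym (pos-h-index u∈)) (u<t u∈)))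
      (λ u∈ u′∈ eq → trans (sym (pos-h-index u∈)) (trans (cong (λ i → pos (h i)) eq) (pos-h-index u′∈)))
    index→image : # L? ≤ count H? t
    index→image = length-≤-by-injection _≟ℕ_ (λ i → pos (h i)) (filter L? (allFin r)) (filter H? (upTo t))
      (filter-allFin-Unique L?)
      (λ {i} i∈ → ∈-filter-upTo⁺ H? (∈-filter-allFin⁻ L? i∈) (i , sym (^-pos (h i))))
      (λ _ _ eq → h-injective (pos-injective eq))

  rank : Fin r → ℕ
  rank j = # (l<? (l j))

  rank<r : ∀ j → rank j < r
  rank<r j = #<r (l<? (l j)) (n≮n (l j))

  suc-rank-≤ : ∀ {j t} → l j < t → suc (rank j) ≤ # (l<? t)
  suc-rank-≤ {j} {t} lj<t = length-≤-by-injection _≟ᶠ_ (λ i → i) (j ∷ filter (l<? (l j)) (allFin r)) (filter (l<? t) (allFin r))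
    (All.tabulate (λ i∈ j≡i → n≮n (l j) (subst (λ i → l i < l j) (sym j≡i) (∈-filter-allFin⁻ (l<? (l j)) i∈))) ∷ filter-allFin-Unique _)
    (λ { (here refl) → ∈-filter-allFin⁺ (l<? t) lj<t
       ; (there i∈) → ∈-filter-allFin⁺ (l<? t) (<-trans (∈-filter-allFin⁻ (l<? (l j)) i∈) lj<t) })
    (λ _ _ i≡j → i≡j)

  rank-injective : ∀ {i j} → rank i ≡ rank j → i ≡ j
  rank-injective {i} {j} eq with <-cmp (l i) (l j)
  ... | tri≈ _ li≡lj _ = l-injective li≡lj
  ... | tri< li<lj _ _ = ⊥-elim (<-irrefl eq (suc-rank-≤ li<lj))
  ... | tri> _ _ lj<li = ⊥-elim (<-irrefl (sym eq) (suc-rank-≤ lj<li))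

  rank-surjective : ∀ {h} → h < r → ∃ λ j → rank j ≡ h
  rank-surjective {h} h<r with any? (λ j → rank j ≟ℕ h)
  ... | yes hit = hit
  ... | no miss = ⊥-elim (<-irrefl refl (begin-strict
    r                              ≡⟨ sym (length-allFin r) ⟩
    length (allFin r)              ≤⟨ into-others ⟩
    length (filter ≢h? (upTo r))   <⟨ filter-notAll ≢h? (upTo r) (Any.map (λ { refl ¬≢ → ¬≢ refl }) (∈-upTo⁺ h<r)) ⟩
    length (upTo r)                ≡⟨ length-upTo r ⟩
    r                              ∎))
    where
    open ≤-Reasoning
    ≢h? : ∀ u → Dec (¬ u ≡ h)
    ≢h? u = ¬? (u ≟ℕ h)
    into-others : length (allFin r) ≤ length (filter ≢h? (upTo r))
    into-others = length-≤-by-injection _≟ℕ_ rank (allFin r) (filter ≢h? (upTo r)) (allFin⁺ r)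
      (λ {j} _ → ∈-filter-upTo⁺ ≢h? (rank<r j) (λ eq → miss (j , eq))) (λ _ _ eq → rank-injective eq)

  w : ℕ
  w = # Wr?

  -- Ranks list the wrapping intervals first, then the others in order of their starts.
  rank-≥-¬Wr : ∀ {j} → ¬ Wr j → w + # (s<? (s j)) ≤ rank j
  rank-≥-¬Wr {j} ¬wj = subst (_≤ rank j) (length-++ (filter Wr? (allFin r)))
    (length-≤-by-injection _≟ᶠ_ (λ i → i) (filter Wr? (allFin r) ++ filter (s<? (s j)) (allFin r)) (filter (l<? (l j)) (allFin r))
      (++⁺ (filter-allFin-Unique Wr?) (filter-allFin-Unique _)
        (λ (wi , si<sj) → ¬Wr-of-s-< ¬wj (∈-filter-allFin⁻ (s<? (s j)) si<sj) (∈-filter-allFin⁻ Wr? wi)))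
      before-j (λ _ _ eq → eq))
    where
    before-j : ∀ {i} → i ∈ filter Wr? (allFin r) ++ filter (s<? (s j)) (allFin r) → i ∈ filter (l<? (l j)) (allFin r)
    before-j {i} i∈ with ∈-++⁻ (filter Wr? (allFin r)) i∈
    ... | inj₁ wi = ∈-filter-allFin⁺ _ (l-<-wrapping (∈-filter-allFin⁻ Wr? wi) ¬wj)
    ... | inj₂ si<sj = ∈-filter-allFin⁺ _ (l-<-of-s-< (λ wi → ⊥-elim (¬Wr-of-s-< ¬wj si<sj′ wi)) (λ wj → ⊥-elim (¬wj wj)) si<sj′)
      where
      si<sj′ : s i < s j
      si<sj′ = ∈-filter-allFin⁻ (s<? (s j)) si<sj

  rank-≥-Wr : ∀ {j} → Wr j → # (s<? (s j)) ≤ # ¬Wr? + rank j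
  rank-≥-Wr {j} wj = subst (# (s<? (s j)) ≤_) (length-++ (filter ¬Wr? (allFin r)))
    (length-≤-by-injection _≟ᶠ_ (λ i → i) (filter (s<? (s j)) (allFin r)) (filter ¬Wr? (allFin r) ++ filter (l<? (l j)) (allFin r))
      (filter-allFin-Unique _) before-j (λ _ _ eq → eq))
    where
    before-j : ∀ {i} → i ∈ filter (s<? (s j)) (allFin r) → i ∈ filter ¬Wr? (allFin r) ++ filter (l<? (l j)) (allFin r)
    before-j {i} si<sj with Wr? i
    ... | no ¬wi = ∈-++⁺ˡ (∈-filter-allFin⁺ ¬Wr? ¬wi)
    ... | yes wi = ∈-++⁺ʳ (filter ¬Wr? (allFin r))
      (∈-filter-allFin⁺ _ (l-<-of-s-< (λ _ → wj) (λ _ → wi) (∈-filter-allFin⁻ (s<? (s j)) si<sj)))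

  #s<-shift : ∀ {j t} → t < s j → # (s<? (suc t)) ≤ # (s<? (s j))
  #s<-shift t<sj = #-mono (s<? (suc _)) (s<? (s _)) (λ si≤t → ≤-<-trans (≤-pred si≤t) t<sj)

  -- The two diagram inequalities at a North step at time t and height rank j, resp. rank j + r.
  inWindow-of-rank : ∀ {j t} → # (l<? t) ≤ rank j → suc (rank j) ≤ w + # (s<? (suc t)) → InWindow (𝓘 j) t
  inWindow-of-rank {j} {t} lo hi with l j <? t
  ... | yes lj<t = ⊥-elim (<-irrefl refl (<-≤-trans (suc-rank-≤ lj<t) lo))
  ... | no lj≮t with Wr? j
  ...   | yes wj = inj₂ (subst (t + n <_) (suc-l-wrap wj) (+-monoˡ-< n (s≤s (≮⇒≥ lj≮t))))
  ...   | no ¬wj with s j ≤? t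
  ...     | yes sj≤t = inj₁ (sj≤t , subst (t <_) (suc-l ¬wj) (s≤s (≮⇒≥ lj≮t)))
  ...     | no sj≰t = ⊥-elim (<-irrefl refl (<-≤-trans hi (≤-trans (+-monoʳ-≤ w (#s<-shift (≰⇒> sj≰t))) (rank-≥-¬Wr ¬wj))))

  inWindow-of-rank+r : ∀ {j t} → rank j < w → suc (rank j + r) ≤ w + # (s<? (suc t)) → t < n → InWindow (𝓘 j) t
  inWindow-of-rank+r {j} {t} rank<w hi t<n with Wr? j
  ... | no ¬wj = ⊥-elim (<⇒≱ rank<w (≤-trans (m≤m+n w _) (rank-≥-¬Wr ¬wj)))
  ... | yes wj with s j ≤? t
  ...   | yes sj≤t = inj₁ (sj≤t , <-trans t<n wj)
  ...   | no sj≰t = ⊥-elim (<-irrefl refl (<-≤-trans hi (begin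
    w + # (s<? (suc t))     ≤⟨ +-monoʳ-≤ w (≤-trans (#s<-shift (≰⇒> sj≰t)) (rank-≥-Wr wj)) ⟩
    w + (# ¬Wr? + rank j)   ≡⟨ sym (+-assoc w _ (rank j)) ⟩
    (w + # ¬Wr?) + rank j   ≡⟨ cong (_+ rank j) (#+#∁≡r Wr?) ⟩
    r + rank j              ≡⟨ +-comm r (rank j) ⟩
    rank j + r              ∎)))
    where open ≤-Reasoning

  open Diagram m r σ 𝓘 x

  northP≡#l< : ∀ {d} → d ≤ n → northP d ≡ # (l<? d)
  northP≡#l< = count-image (λ i → lastElem σ (𝓘 i)) (λ eq → l-injective (cong pos eq))

  northQ≡#s< : ∀ {d} → d ≤ n → northQ d ≡ # (s<? d)
  northQ≡#s< = count-image (λ i → first (𝓘 i)) (λ eq → s-injective (cong pos eq))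

  k-1≡w : k-1 ≡ w
  k-1≡w = length-filter-cong _ Wr? (allFin r)
    (λ {i} _ → Equivalence.to (wraps⇔ (𝓘 i))) (λ {i} _ → Equivalence.from (wraps⇔ (𝓘 i)))

  north? : ∀ d → Dec (d ≡ North)
  north? East = no (λ ())
  north? North = yes refl

  east? : ∀ d → Dec (d ≡ East)
  east? East = yes refl
  east? North = no (λ ())

  module Walk (g : ℕ → Dir) (i : ℕ) (1≤i : 1 ≤ i) (i≤k : i ≤ k) where

    NC EC : ℕ → ℕ
    NC = count (λ t → north? (g t))
    EC = count (λ t → east? (g t))

    pt : ℕ → Point
    pt d = (EC d + (k ∸ i) , NC d + (i ∸ 1))

    height : ℕ → ℕ
    height d = NC d + (i ∸ 1)

    counts-suc : ∀ d → (g d ≡ North × EC (suc d) ≡ EC d × NC (suc d) ≡ suc (NC d))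
                     ⊎ (g d ≡ East × EC (suc d) ≡ suc (EC d) × NC (suc d) ≡ NC d)
    counts-suc d with g d in gd
    ... | North = inj₁ (refl , count-suc-no (λ t → east? (g t)) (λ ge → North≢East (trans (sym gd) ge)) , count-suc-yes (λ t → north? (g t)) gd)
      where
      North≢East : ¬ North ≡ East
      North≢East ()
    ... | East = inj₂ (refl , count-suc-yes (λ t → east? (g t)) gd , count-suc-no (λ t → north? (g t)) (λ gn → East≢North (trans (sym gd) gn)))
      where
      East≢North : ¬ East ≡ North
      East≢North ()

    move-pt : ∀ o → move (pt o) (g o) ≡ pt (suc o)
    move-pt o with counts-suc o
    ... | inj₁ (go , EC≡ , NC≡) rewrite go = sym (cong₂ _,_ (cong (_+ (k ∸ i)) EC≡) (cong (_+ (i ∸ 1)) NC≡))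
    ... | inj₂ (go , EC≡ , NC≡) rewrite go = sym (cong₂ _,_ (cong (_+ (k ∸ i)) EC≡) (cong (_+ (i ∸ 1)) NC≡))

    EC+NC : ∀ d → EC d + NC d ≡ d
    EC+NC zero = refl
    EC+NC (suc d) with counts-suc d
    ... | inj₁ (_ , EC≡ , NC≡) = trans (cong₂ _+_ EC≡ NC≡) (trans (+-suc _ _) (cong suc (EC+NC d)))
    ... | inj₂ (_ , EC≡ , NC≡) = trans (cong₂ _+_ EC≡ NC≡) (cong suc (EC+NC d))

    endOf-steps : ∀ o len → endOf (pt o) (steps g o len) ≡ pt (o + len)
    endOf-steps o zero = cong pt (sym (+-identityʳ o))
    endOf-steps o (suc len) = trans (cong (λ q → endOf q (steps g (suc o) len)) (move-pt o))
      (trans (endOf-steps (suc o) len) (cong pt (sym (+-suc o len))))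

    uses⇐ : ∀ o len → (∀ d → d ≤ len → InRegion (pt (o + d))) → UsesDiagramSteps (pt o) (steps g o len)
    uses⇐ o zero _ = tt
    uses⇐ o (suc len) reg =
      subst InRegion (cong pt (+-identityʳ o)) (reg 0 z≤n) ,
      subst InRegion (trans (cong pt (+-comm o 1)) (sym (move-pt o))) (reg 1 (s≤s z≤n)) ,
      subst (λ q → UsesDiagramSteps q (steps g (suc o) len)) (sym (move-pt o))
        (uses⇐ (suc o) len (λ d d≤len → subst InRegion (cong pt (+-suc o d)) (reg (suc d) (s≤s d≤len))))

    uses⇒ : ∀ o len → 0 < len → UsesDiagramSteps (pt o) (steps g o len) → ∀ d → d ≤ len → InRegion (pt (o + d))
    uses⇒ o (suc len) _ (start-in , _ , _) zero _ = subst InRegion (cong pt (sym (+-identityʳ o))) start-in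
    uses⇒ o (suc zero) _ (_ , next , _) (suc zero) _ = subst InRegion (trans (move-pt o) (cong pt (+-comm 1 o))) next
    uses⇒ o (suc zero) _ _ (suc (suc _)) (s≤s ())
    uses⇒ o (suc (suc len)) _ (_ , _ , rest) (suc d) (s≤s d≤len) =
      subst InRegion (cong pt (sym (+-suc o d)))
        (uses⇒ (suc o) (suc len) (s≤s z≤n) (subst (λ q → UsesDiagramSteps q (steps g (suc o) (suc len))) (move-pt o) rest) d d≤len)

    private
      k∸i+i∸1 : (k ∸ i) + (i ∸ 1) ≡ k-1
      k∸i+i∸1 = go 1≤i i≤k
        where
        go : ∀ {j K} → 1 ≤ j → j ≤ suc K → (suc K ∸ j) + (j ∸ 1) ≡ K
        go {suc j} _ (s≤s j≤K) = m∸n+n≡m j≤K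

      pt-on-diagonal : ∀ d → (EC d + (k ∸ i)) + height d ≡ k-1 + d
      pt-on-diagonal d = begin
        (EC d + (k ∸ i)) + (NC d + (i ∸ 1)) ≡⟨ interchange (EC d) (k ∸ i) (NC d) (i ∸ 1) ⟩
        (EC d + NC d) + ((k ∸ i) + (i ∸ 1)) ≡⟨ cong₂ _+_ (EC+NC d) k∸i+i∸1 ⟩
        d + k-1                             ≡⟨ +-comm d k-1 ⟩
        k-1 + d                             ∎
        where
        open ≡-Reasoning
        interchange : ∀ a b c d → (a + b) + (c + d) ≡ (a + c) + (b + d)
        interchange = solve-∀

    pt-inRegion : ∀ {d} → d ≤ n → northP d ≤ height d → height d ≤ k-1 + northQ d → InRegion (pt d)
    pt-inRegion {d} d≤n lo hi = d , d≤n , pt-on-diagonal d , lo , hi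

    pt-inRegion⁻ : ∀ {d} → InRegion (pt d) → northP d ≤ height d × height d ≤ k-1 + northQ d
    pt-inRegion⁻ {d} (d′ , _ , on-diagonal , lo , hi) =
      subst (λ q → northP q ≤ height d × height d ≤ k-1 + northQ q) (sym d≡d′) (lo , hi)
      where
      d≡d′ : d ≡ d′
      d≡d′ = +-cancelˡ-≡ k-1 d d′ (trans (sym (pt-on-diagonal d)) on-diagonal)

  count-orbit-∈ : ∀ B → count (λ t → σ ^ t · x ∈? B) n ≡ size B
  count-orbit-∈ B = ≤-antisym orbit→set set→orbit
    where
    B? : ∀ t → Dec (σ ^ t · x ∈ˢ B)
    B? t = σ ^ t · x ∈? B
    orbit→set : count B? n ≤ size B
    orbit→set = length-≤-by-injection _≟ᶠ_ (λ t → σ ^ t · x) (filter B? (upTo n)) (filter (_∈? B) (allFin n))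
      (filter-upTo-Unique B? n) (λ t∈ → ∈-filter⁺ (_∈? B) (∈-allFin _) (proj₂ (∈-filter-upTo⁻ B? {n} t∈)))
      (λ t∈ t′∈ → orbit-injective (proj₁ (∈-filter-upTo⁻ B? {n} t∈)) (proj₁ (∈-filter-upTo⁻ B? {n} t′∈)))
    set→orbit : size B ≤ count B? n
    set→orbit = length-≤-by-injection _≟ℕ_ pos (filter (_∈? B) (allFin n)) (filter B? (upTo n)) (filter⁺ (_∈? B) (allFin⁺ n))
      (λ {y} y∈ → ∈-filter-upTo⁺ B? (pos<n y) (subst (_∈ˢ B) (sym (^-pos y)) (proj₂ (∈-filter⁻ (_∈? B) {xs = allFin n} y∈))))
      (λ _ _ → pos-injective)

  module _ {{_ : NonZero r}} where

    row : ℕ → Fin r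
    row h = proj₁ (rank-surjective (m%n<n h r))

    rank-row : ∀ h → rank (row h) ≡ h % r
    rank-row h = proj₂ (rank-surjective (m%n<n h r))

    rank-row-cases : ∀ {h} → h < r + r → rank (row h) ≡ h ⊎ rank (row h) + r ≡ h
    rank-row-cases {h} h<2r with %-cases h<2r
    ... | inj₁ (_ , h%r≡h) = inj₁ (trans (rank-row h) h%r≡h)
    ... | inj₂ (_ , h%r+r≡h) = inj₂ (trans (cong (_+ r) (rank-row h)) h%r+r≡h)

  -- The North step at height h of a path in the diagram lies in the interval of rank h mod r.
  module FromPath {{_ : NonZero r}} (B : Subset n) (i : ℕ) (1≤i : 1 ≤ i) (i≤k : i ≤ k) (R : Vec Dir n)
      (endR : endOf (p i) R ≡ p′ i) (usesR : UsesDiagramSteps (p i) R)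
      (labels : ∀ y → (y ∈ˢ B) ⇔ (∃ λ (t : Fin n) → lookup R t ≡ North × σ ^ toℕ t · x ≡ y)) where

    g : ℕ → Dir
    g = lookupᴺ East R

    open Walk g i 1≤i i≤k

    steps-g : steps g 0 n ≡ R
    steps-g = steps-lookupᴺ East R

    inRegion : ∀ {d} → d ≤ n → InRegion (pt d)
    inRegion {d} = uses⇒ 0 n 0<n (subst (UsesDiagramSteps (p i)) (sym steps-g) usesR) d

    pt-n : pt n ≡ p′ i
    pt-n = trans (sym (endOf-steps 0 n)) (trans (cong (endOf (p i)) steps-g) endR)

    NC-n : NC n ≡ r
    NC-n = +-cancelʳ-≡ (i ∸ 1) (NC n) r (trans (cong proj₂ pt-n) (+-comm (i ∸ 1) r))

    north⇒∈B : ∀ {t} → t < n → g t ≡ North → σ ^ t · x ∈ˢ B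
    north⇒∈B {t} t<n gt = Equivalence.from (labels _) (fromℕ< t<n ,
      trans (lookup≡lookupᴺ East R (fromℕ< t<n)) (trans (cong g (toℕ-fromℕ< t<n)) gt) ,
      cong (λ u → σ ^ u · x) (toℕ-fromℕ< t<n))

    ∈B⇒north : ∀ {t} → t < n → σ ^ t · x ∈ˢ B → g t ≡ North
    ∈B⇒north {t} t<n ∈B with Equivalence.to (labels _) ∈B
    ... | f , Rf , σf≡σt =
      subst (λ u → g u ≡ North) (orbit-injective (toℕ<n f) t<n σf≡σt) (trans (sym (lookup≡lookupᴺ East R f)) Rf)

    size-B : size B ≡ r
    size-B = trans (sym (count-orbit-∈ B)) (trans (length-filter-cong _ (λ t → north? (g t)) (upTo n)
      (λ t∈ → ∈B⇒north (∈-upTo⁻ t∈)) (λ t∈ → north⇒∈B (∈-upTo⁻ t∈))) NC-n)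

    i-1≤w : i ∸ 1 ≤ w
    i-1≤w = subst (i ∸ 1 ≤_) k-1≡w (∸-monoˡ-≤ 1 i≤k)

    NC<r : ∀ {t} → t < n → g t ≡ North → NC t < r
    NC<r {t} t<n gt = subst (NC t <_) NC-n (count-< (λ t → north? (g t)) t<n gt)

    height<i-1+r : ∀ {t} → t < n → g t ≡ North → height t < (i ∸ 1) + r
    height<i-1+r {t} t<n gt = subst (height t <_) (+-comm r (i ∸ 1)) (+-monoˡ-< (i ∸ 1) (NC<r t<n gt))

    #l<≤height : ∀ {t} → t ≤ n → # (l<? t) ≤ height t
    #l<≤height {t} t≤n = subst (_≤ height t) (northP≡#l< t≤n) (proj₁ (pt-inRegion⁻ {t} (inRegion t≤n)))

    suc-height≤ : ∀ {t} → t < n → g t ≡ North → suc (height t) ≤ w + # (s<? (suc t))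
    suc-height≤ {t} t<n gt = subst₂ _≤_ (cong (_+ (i ∸ 1)) (count-suc-yes (λ t → north? (g t)) gt)) (cong₂ _+_ k-1≡w (northQ≡#s< t<n))
      (proj₂ (pt-inRegion⁻ {suc t} (inRegion t<n)))

    i-1≤r : i ∸ 1 ≤ r
    i-1≤r = ≤-trans i-1≤w (#≤r Wr?)

    height<w+r : ∀ {t} → t < n → g t ≡ North → height t < w + r
    height<w+r t<n gt = <-≤-trans (height<i-1+r t<n gt) (+-monoˡ-≤ r i-1≤w)

    north-inWindow : ∀ {t} → t < n → g t ≡ North → InWindow (𝓘 (row (height t))) t
    north-inWindow {t} t<n gt with rank-row-cases (<-≤-trans (height<w+r t<n gt) (+-monoˡ-≤ r (#≤r Wr?)))
    ... | inj₁ rank≡h = inWindow-of-rank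
      (subst (# (l<? t) ≤_) (sym rank≡h) (#l<≤height (<⇒≤ t<n)))
      (subst (λ h → suc h ≤ w + # (s<? (suc t))) (sym rank≡h) (suc-height≤ t<n gt))
    ... | inj₂ rank+r≡h = inWindow-of-rank+r
      (+-cancelʳ-< r _ w (subst (_< w + r) (sym rank+r≡h) (height<w+r t<n gt)))
      (subst (λ h → suc h ≤ w + # (s<? (suc t))) (sym rank+r≡h) (suc-height≤ t<n gt)) t<n

    φ : Fin n → Fin r
    φ y = row (height (pos y))

    north-pos : ∀ {y} → y ∈ˢ B → g (pos y) ≡ North
    north-pos {y} y∈B = ∈B⇒north (pos<n y) (subst (_∈ˢ B) (sym (^-pos y)) y∈B)

    φ-matching : IsMatching B φ
    φ-matching = (λ y y∈B → inWindow⇒elem (𝓘 (φ y)) y (north-inWindow (pos<n y) (north-pos y∈B))) , injective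
      where
      injective : ∀ y z → y ∈ˢ B → z ∈ˢ B → φ y ≡ φ z → y ≡ z
      injective y z y∈B z∈B φy≡φz = pos-injective (count-injective (λ t → north? (g t)) (north-pos y∈B) (north-pos z∈B)
        (+-cancelʳ-≡ (i ∸ 1) _ _ (%-injective-on-window i-1≤r (m≤n+m _ _) (m≤n+m _ _)
          (height<i-1+r (pos<n y) (north-pos y∈B)) (height<i-1+r (pos<n z) (north-pos z∈B))
          (trans (sym (rank-row _)) (trans (cong rank φy≡φz) (rank-row _))))))

    isBasis : IsBasis σ 𝓘 B
    isBasis = (φ , φ-matching) , maximal-of-size size-B

  -- The path of a basis B goes North exactly at the elements of B and starts at p (c + 1), where c counts
  -- the wrapping intervals whose B-element lies in their unwrapped part [start, n).
  module ToPath (B : Subset n) (φ : Fin n → Fin r) (φ-matching : IsMatching B φ) (size-B : size B ≡ r) where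

    B? : ∀ t → Dec (σ ^ t · x ∈ˢ B)
    B? t = σ ^ t · x ∈? B

    matchedAt : ℕ → Fin r
    matchedAt t = φ (σ ^ t · x)

    matchedAt-injective : ∀ {t t′} → t < n → t′ < n → σ ^ t · x ∈ˢ B → σ ^ t′ · x ∈ˢ B →
      matchedAt t ≡ matchedAt t′ → t ≡ t′
    matchedAt-injective t<n t′<n ∈B ∈B′ eq = orbit-injective t<n t′<n (proj₂ φ-matching _ _ ∈B ∈B′ eq)

    inWindow-matchedAt : ∀ {t} → t < n → σ ^ t · x ∈ˢ B → InWindow (𝓘 (matchedAt t)) t
    inWindow-matchedAt {t} t<n ∈B = subst (InWindow (𝓘 (matchedAt t))) (pos-^ t<n) (elem⇒inWindow (𝓘 (matchedAt t)) (proj₁ φ-matching _ ∈B))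

    UnwrappedMatch : Fin r → Set
    UnwrappedMatch J = ∃ λ y → y ∈ˢ B × φ y ≡ J × s J ≤ pos y

    UnwrappedMatch? : ∀ J → Dec (UnwrappedMatch J)
    UnwrappedMatch? J = any? (λ y → (y ∈? B) ×-dec ((φ y ≟ᶠ J) ×-dec (s J ≤? pos y)))

    WU? : ∀ J → Dec (Wr J × UnwrappedMatch J)
    WU? J = Wr? J ×-dec UnwrappedMatch? J

    W¬U? : ∀ J → Dec (Wr J × ¬ UnwrappedMatch J)
    W¬U? J = Wr? J ×-dec ¬? (UnwrappedMatch? J)

    c : ℕ
    c = # WU?

    c+#W¬U≡w : c + # W¬U? ≡ w
    c+#W¬U≡w = trans
      (cong₂ _+_ (sym (length-filter-× Wr? UnwrappedMatch? (allFin r))) (sym (length-filter-× Wr? (λ J → ¬? (UnwrappedMatch? J)) (allFin r))))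
      (length-filter-partition UnwrappedMatch? (filter Wr? (allFin r)))

    -- An element of B at position t < d is matched to an interval starting before d, or else
    -- t lies in the wrapped part of its interval, whose B-element is then not in the unwrapped part.
    count-B-≤ : ∀ {d} → d ≤ n → count B? d ≤ # W¬U? + # (s<? d)
    count-B-≤ {d} d≤n = subst (count B? d ≤_) (length-++ (filter W¬U? (allFin r)))
      (length-≤-by-injection _≟ᶠ_ matchedAt (filter B? (upTo d)) (filter W¬U? (allFin r) ++ filter (s<? d) (allFin r))
        (filter-upTo-Unique B? d) into
        (λ t∈ t′∈ → matchedAt-injective (t<n t∈) (t<n t′∈) (∈B t∈) (∈B t′∈)))
      where
      module _ {t} (t∈ : t ∈ filter B? (upTo d)) where
        t<d : t < d
        t<d = proj₁ (∈-filter-upTo⁻ B? {d} t∈)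
        t<n : t < n
        t<n = <-≤-trans t<d d≤n
        ∈B : σ ^ t · x ∈ˢ B
        ∈B = proj₂ (∈-filter-upTo⁻ B? {d} t∈)
      into : ∀ {t} → t ∈ filter B? (upTo d) → matchedAt t ∈ filter W¬U? (allFin r) ++ filter (s<? d) (allFin r)
      into {t} t∈ with s (matchedAt t) <? d
      ... | yes s<d = ∈-++⁺ʳ (filter W¬U? (allFin r)) (∈-filter-allFin⁺ (s<? d) s<d)
      ... | no s≮d with inWindow-matchedAt (t<n t∈) (∈B t∈)
      ...   | inj₁ (s≤t , _) = ⊥-elim (s≮d (≤-<-trans s≤t (t<d t∈)))
      ...   | inj₂ t+n<e = ∈-++⁺ˡ (∈-filter-allFin⁺ W¬U? (≤-<-trans (m≤n+m n t) t+n<e , ¬unwrapped))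
        where
        ¬unwrapped : ¬ UnwrappedMatch (matchedAt t)
        ¬unwrapped (y , y∈B , φy≡ , s≤pos-y) = s≮d (≤-<-trans (subst (s (matchedAt t) ≤_) pos-y≡t s≤pos-y) (t<d t∈))
          where
          pos-y≡t : pos y ≡ t
          pos-y≡t = trans (cong pos (proj₂ φ-matching y (σ ^ t · x) y∈B (∈B t∈) φy≡)) (pos-^ (t<n t∈))

    -- An element of B at position t ≥ d is matched to an interval ending at or after d, or else
    -- that interval wraps and t lies in its unwrapped part.
    count-B-from-≤ : ∀ d → count (from? B? d) n ≤ # (l≮? d) + c
    count-B-from-≤ d = subst (count (from? B? d) n ≤_) (length-++ (filter (l≮? d) (allFin r)))
      (length-≤-by-injection _≟ᶠ_ matchedAt (filter (from? B? d) (upTo n)) (filter (l≮? d) (allFin r) ++ filter WU? (allFin r))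
        (filter-upTo-Unique (from? B? d) n) into
        (λ t∈ t′∈ → matchedAt-injective (t<n t∈) (t<n t′∈) (∈B t∈) (∈B t′∈)))
      where
      module _ {t} (t∈ : t ∈ filter (from? B? d) (upTo n)) where
        t<n : t < n
        t<n = proj₁ (∈-filter-upTo⁻ (from? B? d) {n} t∈)
        d≤t : d ≤ t
        d≤t = proj₁ (proj₂ (∈-filter-upTo⁻ (from? B? d) {n} t∈))
        ∈B : σ ^ t · x ∈ˢ B
        ∈B = proj₂ (proj₂ (∈-filter-upTo⁻ (from? B? d) {n} t∈))
      into : ∀ {t} → t ∈ filter (from? B? d) (upTo n) → matchedAt t ∈ filter (l≮? d) (allFin r) ++ filter WU? (allFin r)
      into {t} t∈ with l (matchedAt t) <? d
      ... | no l≮d = ∈-++⁺ˡ (∈-filter-allFin⁺ (l≮? d) l≮d)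
      ... | yes l<d with Wr? (matchedAt t) | inWindow-matchedAt (t<n t∈) (∈B t∈)
      ...   | yes wJ | inj₁ (s≤t , _) = ∈-++⁺ʳ (filter (l≮? d) (allFin r))
        (∈-filter-allFin⁺ WU? (wJ , σ ^ t · x , ∈B t∈ , refl , subst (s (matchedAt t) ≤_) (sym (pos-^ (t<n t∈))) s≤t))
      ...   | yes wJ | inj₂ t+n<e = ⊥-elim (<-irrefl refl (<-≤-trans (≤-<-trans (≤-pred t<suc-l) l<d) (d≤t t∈)))
        where
        t<suc-l : suc t ≤ suc (l (matchedAt t))
        t<suc-l = +-cancelʳ-≤ n (suc t) _ (subst (suc t + n ≤_) (sym (suc-l-wrap wJ)) t+n<e)
      ...   | no ¬wJ | inj₁ (_ , t<e) =
        ⊥-elim (<-irrefl refl (<-≤-trans (≤-<-trans (≤-pred (subst (suc t ≤_) (sym (suc-l ¬wJ)) t<e)) l<d) (d≤t t∈)))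
      ...   | no ¬wJ | inj₂ t+n<e = ⊥-elim (¬wJ (≤-<-trans (m≤n+m n t) t+n<e))

    gB : ℕ → Dir
    gB t with B? t
    ... | yes _ = North
    ... | no _ = East

    gB-north⇒∈B : ∀ {t} → gB t ≡ North → σ ^ t · x ∈ˢ B
    gB-north⇒∈B {t} gt with B? t
    ... | yes ∈B = ∈B
    gB-north⇒∈B {t} () | no _

    ∈B⇒gB-north : ∀ {t} → σ ^ t · x ∈ˢ B → gB t ≡ North
    ∈B⇒gB-north {t} ∈B with B? t
    ... | yes _ = refl
    ... | no ∉B = ⊥-elim (∉B ∈B)

    c+1≤k : suc c ≤ k
    c+1≤k = s≤s (subst (c ≤_) (sym k-1≡w) (subst (c ≤_) c+#W¬U≡w (m≤m+n c _)))

    open Walk gB (suc c) (s≤s z≤n) c+1≤k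

    NC≡count-B : ∀ d → NC d ≡ count B? d
    NC≡count-B d = length-filter-cong (λ t → north? (gB t)) B? (upTo d) (λ _ → gB-north⇒∈B) (λ _ → ∈B⇒gB-north)

    count-B-n : count B? n ≡ r
    count-B-n = trans (count-orbit-∈ B) size-B

    NC-n : NC n ≡ r
    NC-n = trans (NC≡count-B n) count-B-n

    northP≤height : ∀ {d} → d ≤ n → northP d ≤ height d
    northP≤height {d} d≤n = subst (_≤ height d) (sym (northP≡#l< d≤n)) (+-cancelʳ-≤ (# (l≮? d)) _ _ (begin
      # (l<? d) + # (l≮? d)                ≡⟨ #+#∁≡r (l<? d) ⟩
      r                                    ≡⟨ sym count-B-n ⟩
      count B? n                           ≡⟨ count-split B? d≤n ⟩
      count B? d + count (from? B? d) n    ≤⟨ +-monoʳ-≤ (count B? d) (count-B-from-≤ d) ⟩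
      count B? d + (# (l≮? d) + c)         ≡⟨ rearrange (count B? d) (# (l≮? d)) c ⟩
      (count B? d + c) + # (l≮? d)         ≡⟨ cong (λ N → (N + c) + # (l≮? d)) (sym (NC≡count-B d)) ⟩
      height d + # (l≮? d)                 ∎))
      where
      open ≤-Reasoning
      rearrange : ∀ a b e → a + (b + e) ≡ (a + e) + b
      rearrange = solve-∀

    height≤k-1+northQ : ∀ {d} → d ≤ n → height d ≤ k-1 + northQ d
    height≤k-1+northQ {d} d≤n = begin
      NC d + c                       ≡⟨ cong (_+ c) (NC≡count-B d) ⟩
      count B? d + c                 ≤⟨ +-monoˡ-≤ c (count-B-≤ d≤n) ⟩
      (# W¬U? + # (s<? d)) + c       ≡⟨ rearrange c (# W¬U?) (# (s<? d)) ⟩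
      (c + # W¬U?) + # (s<? d)       ≡⟨ cong₂ _+_ (trans c+#W¬U≡w (sym k-1≡w)) (sym (northQ≡#s< d≤n)) ⟩
      k-1 + northQ d                 ∎
      where
      open ≤-Reasoning
      rearrange : ∀ a b e → (b + e) + a ≡ (a + b) + e
      rearrange = solve-∀

    EC-n : EC n ≡ m
    EC-n = +-cancelʳ-≡ r (EC n) m (trans (cong (EC n +_) (sym NC-n)) (EC+NC n))

    R : Vec Dir n
    R = steps gB 0 n

    endR : endOf (p (suc c)) R ≡ p′ (suc c)
    endR = trans (endOf-steps 0 n) (cong₂ _,_ (trans (cong (_+ (k ∸ suc c)) EC-n) (+-comm m _)) (trans (cong (_+ c) NC-n) (+-comm r c)))

    usesR : UsesDiagramSteps (p (suc c)) R
    usesR = uses⇐ 0 n (λ d d≤n → pt-inRegion d≤n (northP≤height d≤n) (height≤k-1+northQ d≤n))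

    labels : ∀ y → (y ∈ˢ B) ⇔ (∃ λ (t : Fin n) → lookup R t ≡ North × σ ^ toℕ t · x ≡ y)
    labels y = mk⇔
      (λ y∈B → fromℕ< (pos<n y) , trans (lookup-steps gB 0 n _) (∈B⇒gB-north (subst (_∈ˢ B) (sym σ^pos) y∈B)) , σ^pos)
      (λ (t , Rt , σ^t≡y) → subst (_∈ˢ B) σ^t≡y (gB-north⇒∈B (trans (sym (lookup-steps gB 0 n t)) Rt)))
      where
      σ^pos : σ ^ toℕ (fromℕ< (pos<n y)) · x ≡ y
      σ^pos = trans (cong (λ u → σ ^ u · x) (toℕ-fromℕ< (pos<n y))) (^-pos y)

    path : HasBasisPath B
    path = suc c , s≤s z≤n , c+1≤k , R , endR , usesR , labels

theorem3p6 : (m r : ℕ) (σ : Permutation′ (m + r)) → IsCyclic σ →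
    (𝓘 : Fin r → Interval (m + r)) → Antichain σ 𝓘 → HasRank σ 𝓘 r →
    (x : Fin (m + r)) (B : Subset (m + r)) →
    IsBasis σ 𝓘 B ⇔ Diagram.HasBasisPath m r σ 𝓘 x B
theorem3p6 m r σ cyc 𝓘 anti ((A , A-independent@(ψ , _) , ∣A∣≡r) , _) x B = mk⇔ basis⇒path path⇒basis
  where
  open Presentation m r σ cyc 𝓘 anti x
  open Transversal σ 𝓘
  basis⇒path : IsBasis σ 𝓘 B → Diagram.HasBasisPath m r σ 𝓘 x B
  basis⇒path basis@((φ , φ-matching) , _) =
    ToPath.path B φ φ-matching (size-basis basis A-independent (trans (sym (∣∣≡size A)) ∣A∣≡r))
  path⇒basis : Diagram.HasBasisPath m r σ 𝓘 x B → IsBasis σ 𝓘 B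
  path⇒basis (i , 1≤i , i≤k , R , endR , usesR , labels) =
    FromPath.isBasis {{nonZeroIndex (ψ x)}} B i 1≤i i≤k R endR usesR labels
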